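{- Let $m\geq 1$, let $T$ be a tree on $2m$ vertices with matching number $m$, and let $D$ be an orientation of $T$. Then $M_1(D)\leq \frac{1}{2}(m^2+5m-4)$, with equality if and only if $D$ is a sink-source orientation of $T_{2m,m}$ (in particular $T\cong T_{2m,m}$).
   Context: For a digraph $D=(V,A)$ with out-degrees $d^{+}$ and in-degrees $d^{ - }$, $M_1(D)=\frac{1}{2}\sum_{uv\in A}(d^{+}_u+d^{ - }_v)$, where $uv$ is an arc from $u$ to $v$. An orientation of a graph replaces each edge $uv$ by exactly one of the arcs $uv$, $vu$; a sink-source orientation is one in which every vertex has in-degree $0$ or out-degree $0$. $T_{2m,m}$ is the tree obtained from the star $K_{1,m}$ by attaching a new pendent vertex to each of $m-1$ of its leaves. -}

module Defs where

open import Data.Nat using (ℕ; zero; suc; _+_; _*_; _≤_; _<_)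
open import Data.Fin using (Fin; toℕ; inject₁; fromℕ) renaming (zero to fzero; suc to fsuc)
import Data.Fin as F
open import Data.Fin.Permutation using (Permutation′; _⟨$⟩ʳ_)
open import Data.Product using (Σ; ∃; _×_; _,_; proj₁; proj₂)
open import Data.Sum using (_⊎_; inj₁; inj₂; [_,_])
open import Data.List using (List; length; filter; map)
open import Data.Nat.ListAction using (sum)
open import Data.List.Membership.Propositional using (_∈_)
open import Data.List.Relation.Unary.Unique.Propositional using (Unique)
open import Relation.Binary.PropositionalEquality using (_≡_)
open import Relation.Binary.Construct.Closure.ReflexiveTransitive using (Star)
open import Relation.Nullary using (¬_)
open import Function.Definitions using (Injective)
open import Function.Bundles using (_⇔_)

Graph : ℕ → Set₁
Graph n = Fin n → Fin n → Set

IsSimple : ∀ {n} → Graph n → Set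
IsSimple {n} G = (∀ u v → G u v → G v u) × (∀ u → ¬ G u u)

Connected : ∀ {n} → Graph n → Set
Connected {n} G = ∀ (u v : Fin n) → Star G u v

-- A cycle: k = l + 3 ≥ 3 pairwise distinct vertices f 0, …, f (k-1),
-- consecutive ones adjacent and f (k-1) adjacent to f 0.
HasCycle : ∀ {n} → Graph n → Set
HasCycle {n} G =
  Σ ℕ λ l → Σ (Fin (suc (suc (suc l))) → Fin n) λ f →
    Injective _≡_ _≡_ f
    × (∀ (i : Fin (suc (suc l))) → G (f (inject₁ i)) (f (fsuc i)))
    × G (f (fromℕ (suc (suc l)))) (f fzero)

IsTree : ∀ {n} → Graph n → Set
IsTree G = IsSimple G × Connected G × ¬ HasCycle G

HasMatchingOfSize : ∀ {n} → Graph n → ℕ → Set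
HasMatchingOfSize {n} G k =
  Σ (Fin k → Fin n) λ g → Σ (Fin k → Fin n) λ h →
    (∀ i → G (g i) (h i)) × Injective _≡_ _≡_ [ g , h ]

MatchingNumber : ∀ {n} → Graph n → ℕ → Set
MatchingNumber G k = HasMatchingOfSize G k × (∀ j → HasMatchingOfSize G j → j ≤ k)

-- A digraph on Fin n, given by its list of arcs (u , v) meaning u → v.
Arcs : ℕ → Set
Arcs n = List (Fin n × Fin n)

IsOrientation : ∀ {n} → Graph n → Arcs n → Set
IsOrientation {n} G D =
  Unique D
  × (∀ u v → (u , v) ∈ D → G u v)
  × (∀ u v → G u v → ((u , v) ∈ D ⊎ (v , u) ∈ D) × ¬ ((u , v) ∈ D × (v , u) ∈ D))

outdeg : ∀ {n} → Arcs n → Fin n → ℕ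
outdeg D u = length (filter (λ a → proj₁ a F.≟ u) D)

indeg : ∀ {n} → Arcs n → Fin n → ℕ
indeg D v = length (filter (λ a → proj₂ a F.≟ v) D)

twiceM1 : ∀ {n} → Arcs n → ℕ
twiceM1 D = sum (map (λ a → outdeg D (proj₁ a) + indeg D (proj₂ a)) D)

SinkSource : ∀ {n} → Arcs n → Set
SinkSource {n} D = ∀ (v : Fin n) → indeg D v ≡ 0 ⊎ outdeg D v ≡ 0

_≅_ : ∀ {n} → Graph n → Graph n → Set
_≅_ {n} G H = Σ (Permutation′ n) λ σ → ∀ u v → G u v ⇔ H (σ ⟨$⟩ʳ u) (σ ⟨$⟩ʳ v)

-- T_{2m,m} on vertices 0 … 2m-1: centre 0, star leaves 1 … m,
-- and pendant vertex m + i attached to leaf i for 1 ≤ i ≤ m-1.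
T-edge : ℕ → ℕ → ℕ → Set
T-edge m a b = (a ≡ 0 × 1 ≤ b × b ≤ m) ⊎ (1 ≤ a × a < m × b ≡ a + m)

T2mm : (m : ℕ) → Graph (2 * m)
T2mm m u v = T-edge m (toℕ u) (toℕ v) ⊎ T-edge m (toℕ v) (toℕ u)

{-# OPTIONS --safe #-}

-- Vertexwise, 2 M₁(D) = Σ_v (d⁺_v² + d⁻_v²) ≤ Σ_v d_v², with equality exactly when D is sink-source.
-- Let {g i , h i} be a perfect matching of T, with degrees a i , b i. As T has 2m - 1 edges,
-- Σ (a i + b i) = 4m - 2, and for m ≥ 2 every pair has a i + b i ≥ 3 (otherwise it would be a
-- component of T). With the excess x i = a i + b i - 3 one has a i² + b i² ≤ x i² + 4 x i + 5 and
-- Σ x i ≤ m - 2, so Σ_v d_v² ≤ (Σ x i)² + 4 Σ x i + 5m ≤ m² + 5m - 4. Equality forces a leaf in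
-- every pair, a single pair of excess m - 2 and all other pairs of excess 0; the non-leaf of the
-- big pair is then adjacent to all other non-leaves, which is T_{2m,m}. Conversely T_{2m,m} has
-- degrees m, 2 (m - 1 times) and 1 (m times), giving m² + 5m - 4.

module Submission where

open import Defs
open import Data.Empty using (⊥; ⊥-elim)
open import Data.Fin as F
  using (Fin; toℕ; inject₁; fromℕ; fromℕ<; punchIn; punchOut; splitAt; join; _↑ˡ_; _↑ʳ_)
  renaming (zero to fzero; suc to fsuc)
import Data.Fin.Properties as FP
open import Data.Fin.Permutation as P
  using (Permutation; Permutation′; _⟨$⟩ʳ_; _⟨$⟩ˡ_; permutation; transpose; flip; _∘ₚ_; cast-id)
open import Data.List using (List; []; _∷_; length; lookup; filter; map)
import Data.Nat.ListAction as List
open import Data.List.Membership.Propositional using (_∈_)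
open import Data.List.Membership.Propositional.Properties using (∈-lookup)
open import Data.List.Relation.Unary.All as All using (All; []; _∷_)
open import Data.List.Relation.Unary.All.Properties using (All¬⇒¬Any; ¬Any⇒All¬)
open import Data.List.Relation.Unary.Any as Any using (here; there; any?)
open import Data.List.Relation.Unary.Unique.Propositional using (Unique)
open import Data.List.Relation.Unary.AllPairs using ([]; _∷_)
open import Data.Nat using (ℕ; zero; suc; _+_; _*_; _∸_; _≤_; _<_; z≤n; s≤s; _≟_; _≤?_)
open import Data.Nat.Properties
open import Data.Nat.Tactic.RingSolver using (solve-∀)
open import Algebra.Properties.CommutativeMonoid.Sum +-0-commutativeMonoid
  using (sum; sum-permute; sum-remove; sum-cong-≗; ∑-distrib-+)
open import Data.Product using (Σ; ∃; _×_; _,_; proj₁; proj₂)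
import Data.Product.Properties as Product
open import Data.Sum using (_⊎_; inj₁; inj₂; [_,_]; [_,_]′; swap)
open import Data.Sum.Properties using (inj₁-injective; inj₂-injective)
open import Function.Base using (_∘_)
open import Function.Bundles using (_⇔_; mk⇔; Equivalence)
open import Function.Properties.Equivalence using () renaming (sym to ⇔-sym; trans to ⇔-trans)
open import Relation.Binary.Construct.Closure.ReflexiveTransitive as Star using (Star; ε; _◅_; _◅◅_)
open import Relation.Nullary using (¬_; ¬?; Dec; yes; no)
open import Relation.Nullary.Decidable using (decidable-stable)
open import Relation.Binary.PropositionalEquality hiding ([_])

-- Indicators and finite sums

𝟙 : ∀ {p} {P : Set p} → Dec P → ℕ
𝟙 (yes _) = 1
𝟙 (no _) = 0

𝟙≤1 : ∀ {p} {P : Set p} (d : Dec P) → 𝟙 d ≤ 1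
𝟙≤1 (yes _) = s≤s z≤n
𝟙≤1 (no _) = z≤n

𝟙-cong : ∀ {p q} {P : Set p} {Q : Set q} → (P → Q) → (Q → P) → (d : Dec P) (e : Dec Q) → 𝟙 d ≡ 𝟙 e
𝟙-cong f g (yes _) (yes _) = refl
𝟙-cong f g (yes p) (no ¬q) = ⊥-elim (¬q (f p))
𝟙-cong f g (no ¬p) (yes q) = ⊥-elim (¬p (g q))
𝟙-cong f g (no _) (no _) = refl

𝟙-yes : ∀ {p} {P : Set p} → P → (d : Dec P) → 𝟙 d ≡ 1
𝟙-yes x (yes _) = refl
𝟙-yes x (no ¬x) = ⊥-elim (¬x x)

𝟙-no : ∀ {p} {P : Set p} → ¬ P → (d : Dec P) → 𝟙 d ≡ 0
𝟙-no ¬x (yes x) = ⊥-elim (¬x x)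
𝟙-no ¬x (no _) = refl

𝟙-⊎ : ∀ {P Q R : Set} → (R → P ⊎ Q) → (P ⊎ Q → R) → (P → Q → ⊥) →
      (r : Dec R) (p : Dec P) (q : Dec Q) → 𝟙 r ≡ 𝟙 p + 𝟙 q
𝟙-⊎ f g disj (yes r) (yes p) (yes q) = ⊥-elim (disj p q)
𝟙-⊎ f g disj (yes r) (yes p) (no _) = refl
𝟙-⊎ f g disj (yes r) (no _) (yes q) = refl
𝟙-⊎ f g disj (yes r) (no ¬p) (no ¬q) = ⊥-elim ([ ¬p , ¬q ] (f r))
𝟙-⊎ f g disj (no ¬r) (yes p) _ = ⊥-elim (¬r (g (inj₁ p)))
𝟙-⊎ f g disj (no ¬r) (no _) (yes q) = ⊥-elim (¬r (g (inj₂ q)))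
𝟙-⊎ f g disj (no ¬r) (no _) (no _) = refl

-- Opaque, so that unification never unfolds sums over `Fin (suc n)`.
opaque
  ∑ : ∀ {n} → (Fin n → ℕ) → ℕ
  ∑ = sum

opaque
  unfolding ∑

  ∑-cong : ∀ {n} {f g : Fin n → ℕ} → (∀ i → f i ≡ g i) → ∑ f ≡ ∑ g
  ∑-cong = sum-cong-≗

  ∑-mono-≤ : ∀ {n} {f g : Fin n → ℕ} → (∀ i → f i ≤ g i) → ∑ f ≤ ∑ g
  ∑-mono-≤ {zero} f≤g = z≤n
  ∑-mono-≤ {suc n} f≤g = +-mono-≤ (f≤g fzero) (∑-mono-≤ (λ i → f≤g (fsuc i)))

  ∑-distrib-+′ : ∀ {n} (f g : Fin n → ℕ) → ∑ (λ i → f i + g i) ≡ ∑ f + ∑ g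
  ∑-distrib-+′ = ∑-distrib-+

  ∑-const : ∀ {n} c → ∑ {n} (λ _ → c) ≡ n * c
  ∑-const {zero} c = refl
  ∑-const {suc n} c = cong (c +_) (∑-const {n} c)

  ∑-*ˡ : ∀ {n} c (f : Fin n → ℕ) → ∑ (λ i → c * f i) ≡ c * ∑ f
  ∑-*ˡ {zero} c f = sym (*-zeroʳ c)
  ∑-*ˡ {suc n} c f = begin
      c * f fzero + ∑ (λ i → c * f (fsuc i)) ≡⟨ cong (c * f fzero +_) (∑-*ˡ c (λ i → f (fsuc i))) ⟩
      c * f fzero + c * ∑ (λ i → f (fsuc i)) ≡⟨ *-distribˡ-+ c _ _ ⟨
      c * ∑ f                                 ∎
    where open ≡-Reasoning

  ∑-empty : (f : Fin 0 → ℕ) → ∑ f ≡ 0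
  ∑-empty f = refl

  ∑-suc : ∀ {n} (f : Fin (suc n) → ℕ) → ∑ f ≡ f fzero + ∑ (λ i → f (fsuc i))
  ∑-suc f = refl

  ∑-remove : ∀ {n} (f : Fin (suc n) → ℕ) (j : Fin (suc n)) → ∑ f ≡ f j + ∑ (λ i → f (punchIn j i))
  ∑-remove f j = sum-remove {i = j} f

  ∑-↑ : ∀ m {n} (f : Fin (m + n) → ℕ) → ∑ f ≡ ∑ (λ i → f (i ↑ˡ n)) + ∑ (λ i → f (m ↑ʳ i))
  ∑-↑ zero f = refl
  ∑-↑ (suc m) f = trans (cong (f fzero +_) (∑-↑ m (λ i → f (fsuc i)))) (sym (+-assoc (f fzero) _ _))

  ∑-permute : ∀ {m n} (π : Permutation m n) (f : Fin n → ℕ) → ∑ f ≡ ∑ (λ i → f (π ⟨$⟩ʳ i))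
  ∑-permute π f = sum-permute f π

∑-0 : ∀ {n} → ∑ {n} (λ _ → 0) ≡ 0
∑-0 {n} = trans (∑-const {n} 0) (*-zeroʳ n)

∑-1 : ∀ {n} → ∑ {n} (λ _ → 1) ≡ n
∑-1 {n} = trans (∑-const {n} 1) (*-identityʳ n)

∑-select : ∀ {n} (f : Fin n → ℕ) (c : Fin n) → ∑ (λ i → f i * 𝟙 (c F.≟ i)) ≡ f c
∑-select {suc n} f c = begin
    ∑ (λ i → f i * 𝟙 (c F.≟ i))
  ≡⟨ ∑-remove _ c ⟩
    f c * 𝟙 (c F.≟ c) + ∑ (λ i → f (punchIn c i) * 𝟙 (c F.≟ punchIn c i))
  ≡⟨ cong₂ _+_ (cong (f c *_) (𝟙-yes refl (c F.≟ c)))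
               (∑-cong (λ i → cong (f (punchIn c i) *_) (𝟙-no (FP.punchInᵢ≢i c i ∘ sym) (c F.≟ punchIn c i)))) ⟩
    f c * 1 + ∑ (λ i → f (punchIn c i) * 0)
  ≡⟨ cong₂ _+_ (*-identityʳ (f c)) (trans (∑-cong (λ i → *-zeroʳ (f (punchIn c i)))) ∑-0) ⟩
    f c + 0
  ≡⟨ +-identityʳ (f c) ⟩
    f c ∎
  where open ≡-Reasoning

∑-𝟙-≡ : ∀ {n} (c : Fin n) → ∑ (λ i → 𝟙 (i F.≟ c)) ≡ 1
∑-𝟙-≡ c = trans (∑-cong (λ i → trans (𝟙-cong sym sym (i F.≟ c) (c F.≟ i)) (sym (*-identityˡ _))))
                (∑-select (λ _ → 1) c)

opaque
  unfolding ∑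

  term≤∑ : ∀ {n} (f : Fin n → ℕ) (a : Fin n) → f a ≤ ∑ f
  term≤∑ {suc n} f a = subst (f a ≤_) (sym (sum-remove {i = a} f)) (m≤m+n _ _)

two-terms≤∑ : ∀ {n} (f : Fin n → ℕ) (a b : Fin n) → a ≢ b → f a + f b ≤ ∑ f
two-terms≤∑ {suc n} f a b a≢b = subst (f a + f b ≤_) (sym (∑-remove f a))
  (+-monoʳ-≤ (f a) (subst (λ x → f x ≤ _) (FP.punchIn-punchOut a≢b)
     (term≤∑ (λ i → f (punchIn a i)) (punchOut a≢b))))

three-terms≤∑ : ∀ {n} (f : Fin n → ℕ) (a b c : Fin n) → a ≢ b → a ≢ c → b ≢ c → f a + f b + f c ≤ ∑ f
three-terms≤∑ {suc n} f a b c a≢b a≢c b≢c = subst (f a + f b + f c ≤_) (sym (∑-remove f a))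
  (subst (_≤ f a + ∑ (λ i → f (punchIn a i))) (sym (+-assoc (f a) (f b) (f c)))
    (+-monoʳ-≤ (f a)
      (subst₂ (λ x y → f x + f y ≤ _) (FP.punchIn-punchOut a≢b) (FP.punchIn-punchOut a≢c)
        (two-terms≤∑ (λ i → f (punchIn a i)) (punchOut a≢b) (punchOut a≢c)
          (b≢c ∘ FP.punchOut-injective a≢b a≢c)))))

∑-indicators<n : ∀ {n} (f : Fin n → ℕ) (j : Fin n) → (∀ i → f i ≤ 1) → f j ≡ 0 → ∑ f < n
∑-indicators<n {suc n} f j f≤1 fj≡0 = begin-strict
    ∑ f                              ≡⟨ ∑-remove f j ⟩
    f j + ∑ (λ i → f (punchIn j i))  ≡⟨ cong (_+ ∑ (λ i → f (punchIn j i))) fj≡0 ⟩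
    ∑ (λ i → f (punchIn j i))        ≤⟨ ∑-mono-≤ (λ i → f≤1 (punchIn j i)) ⟩
    ∑ {n} (λ _ → 1)                  ≡⟨ ∑-1 ⟩
    n                                <⟨ n<1+n n ⟩
    suc n                            ∎
  where open ≤-Reasoning

+-≤-≡⇒≡ : ∀ {a b c d} → a ≤ b → c ≤ d → a + c ≡ b + d → a ≡ b × c ≡ d
+-≤-≡⇒≡ {a} {b} {c} {d} a≤b c≤d eq with m≤n⇒m<n∨m≡n a≤b
... | inj₂ a≡b = a≡b , +-cancelˡ-≡ a c d (trans eq (cong (_+ d) (sym a≡b)))
... | inj₁ a<b = ⊥-elim (<⇒≢ (+-mono-<-≤ a<b c≤d) eq)

∑-mono-≤-≡⇒≡ : ∀ {n} {f g : Fin n → ℕ} → (∀ i → f i ≤ g i) → ∑ f ≡ ∑ g → ∀ i → f i ≡ g i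
∑-mono-≤-≡⇒≡ {suc n} {f} {g} f≤g eq i with +-≤-≡⇒≡ (f≤g fzero) (∑-mono-≤ (f≤g ∘ fsuc)) eq′
  where
  eq′ : f fzero + ∑ (f ∘ fsuc) ≡ g fzero + ∑ (g ∘ fsuc)
  eq′ = trans (sym (∑-suc f)) (trans eq (∑-suc g))
∑-mono-≤-≡⇒≡ f≤g eq fzero    | head≡ , _ = head≡
∑-mono-≤-≡⇒≡ f≤g eq (fsuc i) | _ , tail≡ = ∑-mono-≤-≡⇒≡ (f≤g ∘ fsuc) tail≡ i

square-+ : ∀ a b → (a + b) * (a + b) ≡ a * a + b * b + 2 * (a * b)
square-+ = solve-∀

2*n≡0⇒n≡0 : ∀ {n} → 2 * n ≡ 0 → n ≡ 0
2*n≡0⇒n≡0 {n} e = m*n≡0⇒m≡0 n 2 (trans (*-comm n 2) e)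

square+square≡square-+⇔ : ∀ a b → (a * a + b * b ≡ (a + b) * (a + b)) ⇔ (b ≡ 0 ⊎ a ≡ 0)
square+square≡square-+⇔ a b = mk⇔ to from
  where
  to : a * a + b * b ≡ (a + b) * (a + b) → b ≡ 0 ⊎ a ≡ 0
  to e = swap (m*n≡0⇒m≡0∨n≡0 a (2*n≡0⇒n≡0 (+-cancelˡ-≡ (a * a + b * b) _ 0
           (sym (trans (+-identityʳ _) (trans e (square-+ a b)))))))
  ab≡0 : b ≡ 0 ⊎ a ≡ 0 → a * b ≡ 0
  ab≡0 (inj₁ b≡0) = trans (cong (a *_) b≡0) (*-zeroʳ a)
  ab≡0 (inj₂ a≡0) = cong (_* b) a≡0
  from : b ≡ 0 ⊎ a ≡ 0 → a * a + b * b ≡ (a + b) * (a + b)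
  from ab = sym (trans (square-+ a b) (trans (cong (λ z → a * a + b * b + 2 * z) (ab≡0 ab)) (+-identityʳ _)))

square+square≤square-+ : ∀ a b → a * a + b * b ≤ (a + b) * (a + b)
square+square≤square-+ a b = subst (a * a + b * b ≤_) (sym (square-+ a b)) (m≤m+n _ _)

∑-squares≤square-∑ : ∀ {n} (f : Fin n → ℕ) → ∑ (λ i → f i * f i) ≤ ∑ f * ∑ f
∑-squares≤square-∑ {zero} f = subst₂ _≤_ (sym (∑-empty _)) (sym (cong (λ s → s * s) (∑-empty f))) z≤n
∑-squares≤square-∑ {suc n} f = begin
    ∑ (λ i → f i * f i)                        ≡⟨ ∑-suc _ ⟩
    f fzero * f fzero + ∑ (λ i → f (fsuc i) * f (fsuc i)) ≤⟨ +-monoʳ-≤ _ (∑-squares≤square-∑ (f ∘ fsuc)) ⟩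
    f fzero * f fzero + ∑ (f ∘ fsuc) * ∑ (f ∘ fsuc) ≤⟨ square+square≤square-+ (f fzero) _ ⟩
    (f fzero + ∑ (f ∘ fsuc)) * (f fzero + ∑ (f ∘ fsuc)) ≡⟨ cong (λ s → s * s) (∑-suc f) ⟨
    ∑ f * ∑ f                                  ∎
  where open ≤-Reasoning

∑-squares≡square-∑⇒ : ∀ {n} (f : Fin n → ℕ) → ∑ (λ i → f i * f i) ≡ ∑ f * ∑ f →
                      ∀ j → f j ≡ 0 ⊎ f j ≡ ∑ f
∑-squares≡square-∑⇒ {suc n} f eq j with m*n≡0⇒m≡0∨n≡0 (f j) fjR≡0
  where
  R = ∑ (f ∘ punchIn j)
  bound : f j * f j + R * R + 2 * (f j * R) ≤ f j * f j + R * R + 0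
  bound = begin
    f j * f j + R * R + 2 * (f j * R)          ≡⟨ square-+ (f j) R ⟨
    (f j + R) * (f j + R)                      ≡⟨ cong (λ s → s * s) (∑-remove f j) ⟨
    ∑ f * ∑ f                                  ≡⟨ eq ⟨
    ∑ (λ i → f i * f i)                        ≡⟨ ∑-remove _ j ⟩
    f j * f j + ∑ (λ i → f (punchIn j i) * f (punchIn j i)) ≤⟨ +-monoʳ-≤ _ (∑-squares≤square-∑ (f ∘ punchIn j)) ⟩
    f j * f j + R * R                          ≡⟨ +-identityʳ _ ⟨
    f j * f j + R * R + 0                      ∎
    where open ≤-Reasoning
  fjR≡0 : f j * R ≡ 0
  fjR≡0 with m*n≡0⇒m≡0∨n≡0 2 (n≤0⇒n≡0 (+-cancelˡ-≤ _ _ _ bound))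
  ... | inj₂ fjR≡0 = fjR≡0
... | inj₁ fj≡0 = inj₁ fj≡0
... | inj₂ R≡0 = inj₂ (sym (trans (∑-remove f j) (trans (cong (f j +_) R≡0) (+-identityʳ (f j)))))

∑-squares≡square-∑⇒concentrated : ∀ {n} (f : Fin (suc n) → ℕ) → ∑ (λ i → f i * f i) ≡ ∑ f * ∑ f →
                                   ∃ λ j → f j ≡ ∑ f × (∀ i → i ≢ j → f i ≡ 0)
∑-squares≡square-∑⇒concentrated f eq with FP.any? (λ i → ¬? (f i ≟ 0))
... | yes (j , fj≢0) = j , fj≡∑ , others
  where
  fj≡∑ : f j ≡ ∑ f
  fj≡∑ = [ ⊥-elim ∘ fj≢0 , (λ e → e) ] (∑-squares≡square-∑⇒ f eq j)
  others : ∀ i → i ≢ j → f i ≡ 0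
  others i i≢j with ∑-squares≡square-∑⇒ f eq i
  ... | inj₁ fi≡0 = fi≡0
  ... | inj₂ fi≡∑ = ⊥-elim (fj≢0 (trans fj≡∑ ∑≡0))
    where
    ∑+∑≤∑ : ∑ f + ∑ f ≤ ∑ f + 0
    ∑+∑≤∑ = subst₂ (λ x y → x + y ≤ ∑ f + 0) fi≡∑ fj≡∑
              (subst (f i + f j ≤_) (sym (+-identityʳ _)) (two-terms≤∑ f i j i≢j))
    ∑≡0 : ∑ f ≡ 0
    ∑≡0 = n≤0⇒n≡0 (+-cancelˡ-≤ (∑ f) _ _ ∑+∑≤∑)
... | no ¬∃nonzero = fzero , trans (all-zero fzero) (sym (trans (∑-cong all-zero) ∑-0)) , λ i _ → all-zero i
  where
  all-zero : ∀ i → f i ≡ 0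
  all-zero i with f i ≟ 0
  ... | yes fi≡0 = fi≡0
  ... | no fi≢0 = ⊥-elim (¬∃nonzero (i , fi≢0))

-- Degrees of a digraph

module _ {n : ℕ} where

  _≟ₐ_ : (a b : Fin n × Fin n) → Dec (a ≡ b)
  _≟ₐ_ = Product.≡-dec F._≟_ F._≟_

  _∈?_ : (a : Fin n × Fin n) (D : Arcs n) → Dec (a ∈ D)
  a ∈? D = any? (a ≟ₐ_) D

  count : (Fin n × Fin n → Fin n) → Arcs n → Fin n → ℕ
  count κ D u = length (filter (λ a → κ a F.≟ u) D)

  count-∷ : ∀ κ a D u → count κ (a ∷ D) u ≡ 𝟙 (κ a F.≟ u) + count κ D u
  count-∷ κ a D u with κ a F.≟ u
  ... | yes _ = refl
  ... | no _ = refl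

  sum-map≡∑-*-count : ∀ κ (F : Fin n → ℕ) (D : Arcs n) →
                      List.sum (map (F ∘ κ) D) ≡ ∑ (λ v → F v * count κ D v)
  sum-map≡∑-*-count κ F [] = sym (trans (∑-cong (λ v → *-zeroʳ (F v))) ∑-0)
  sum-map≡∑-*-count κ F (a ∷ D) = begin
      F (κ a) + List.sum (map (F ∘ κ) D)
    ≡⟨ cong₂ _+_ (sym (∑-select F (κ a))) (sum-map≡∑-*-count κ F D) ⟩
      ∑ (λ v → F v * 𝟙 (κ a F.≟ v)) + ∑ (λ v → F v * count κ D v)
    ≡⟨ ∑-distrib-+′ _ _ ⟨
      ∑ (λ v → F v * 𝟙 (κ a F.≟ v) + F v * count κ D v)
    ≡⟨ ∑-cong (λ v → trans (sym (*-distribˡ-+ (F v) _ _)) (cong (F v *_) (sym (count-∷ κ a D v)))) ⟩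
      ∑ (λ v → F v * count κ (a ∷ D) v) ∎
    where open ≡-Reasoning

  sum-map-+ : ∀ (f g : Fin n × Fin n → ℕ) D →
              List.sum (map (λ a → f a + g a) D) ≡ List.sum (map f D) + List.sum (map g D)
  sum-map-+ f g [] = refl
  sum-map-+ f g (a ∷ D) = trans (cong (f a + g a +_) (sum-map-+ f g D)) (+-+-exchange (f a) (g a) _ _)
    where
    +-+-exchange : ∀ w x y z → w + x + (y + z) ≡ w + y + (x + z)
    +-+-exchange = solve-∀

  sum-map-1≡length : ∀ (D : Arcs n) → List.sum (map (λ _ → 1) D) ≡ length D
  sum-map-1≡length [] = refl
  sum-map-1≡length (a ∷ D) = cong suc (sum-map-1≡length D)

  twiceM1≡∑-squares : ∀ (D : Arcs n) →
                      twiceM1 D ≡ ∑ (λ v → outdeg D v * outdeg D v + indeg D v * indeg D v)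
  twiceM1≡∑-squares D = begin
      twiceM1 D
    ≡⟨ sum-map-+ (outdeg D ∘ proj₁) (indeg D ∘ proj₂) D ⟩
      List.sum (map (outdeg D ∘ proj₁) D) + List.sum (map (indeg D ∘ proj₂) D)
    ≡⟨ cong₂ _+_ (sum-map≡∑-*-count proj₁ (outdeg D) D) (sum-map≡∑-*-count proj₂ (indeg D) D) ⟩
      ∑ (λ v → outdeg D v * outdeg D v) + ∑ (λ v → indeg D v * indeg D v)
    ≡⟨ ∑-distrib-+′ _ _ ⟨
      ∑ (λ v → outdeg D v * outdeg D v + indeg D v * indeg D v) ∎
    where open ≡-Reasoning

  ∑-count≡length : ∀ κ (D : Arcs n) → ∑ (count κ D) ≡ length D
  ∑-count≡length κ D = begin
    ∑ (count κ D)                      ≡⟨ ∑-cong (λ v → *-identityˡ _) ⟨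
    ∑ (λ v → 1 * count κ D v)          ≡⟨ sum-map≡∑-*-count κ (λ _ → 1) D ⟨
    List.sum (map (λ _ → 1) D)         ≡⟨ sum-map-1≡length D ⟩
    length D                           ∎
    where open ≡-Reasoning

  𝟙-∈-∷ : ∀ {a D} → All (a ≢_) D → ∀ x → 𝟙 (x ∈? (a ∷ D)) ≡ 𝟙 (x ≟ₐ a) + 𝟙 (x ∈? D)
  𝟙-∈-∷ {a} {D} a∉D x = 𝟙-⊎ Any.toSum Any.fromSum (λ { refl x∈D → All¬⇒¬Any a∉D x∈D })
                            (x ∈? (a ∷ D)) (x ≟ₐ a) (x ∈? D)

  ∑-𝟙-out-arc : ∀ a v → ∑ (λ w → 𝟙 ((v , w) ≟ₐ a)) ≡ 𝟙 (proj₁ a F.≟ v)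
  ∑-𝟙-out-arc (a₁ , a₂) v with a₁ F.≟ v
  ... | yes refl = trans (∑-cong (λ w → 𝟙-cong (cong proj₂) (cong (a₁ ,_)) _ (w F.≟ a₂))) (∑-𝟙-≡ a₂)
  ... | no a₁≢v = trans (∑-cong (λ w → 𝟙-no (λ e → a₁≢v (sym (cong proj₁ e))) _)) ∑-0

  ∑-𝟙-in-arc : ∀ a v → ∑ (λ w → 𝟙 ((w , v) ≟ₐ a)) ≡ 𝟙 (proj₂ a F.≟ v)
  ∑-𝟙-in-arc (a₁ , a₂) v with a₂ F.≟ v
  ... | yes refl = trans (∑-cong (λ w → 𝟙-cong (cong proj₁) (cong (_, a₂)) _ (w F.≟ a₁))) (∑-𝟙-≡ a₁)
  ... | no a₂≢v = trans (∑-cong (λ w → 𝟙-no (λ e → a₂≢v (sym (cong proj₂ e))) _)) ∑-0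

  outdeg≡∑-out-arcs : ∀ (D : Arcs n) → Unique D → ∀ v → outdeg D v ≡ ∑ (λ w → 𝟙 ((v , w) ∈? D))
  outdeg≡∑-out-arcs [] _ v = sym ∑-0
  outdeg≡∑-out-arcs (a ∷ D) (a∉D ∷ uniq) v = begin
      outdeg (a ∷ D) v
    ≡⟨ count-∷ proj₁ a D v ⟩
      𝟙 (proj₁ a F.≟ v) + outdeg D v
    ≡⟨ cong₂ _+_ (sym (∑-𝟙-out-arc a v)) (outdeg≡∑-out-arcs D uniq v) ⟩
      ∑ (λ w → 𝟙 ((v , w) ≟ₐ a)) + ∑ (λ w → 𝟙 ((v , w) ∈? D))
    ≡⟨ trans (∑-cong (λ w → 𝟙-∈-∷ a∉D (v , w))) (∑-distrib-+′ _ _) ⟨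
      ∑ (λ w → 𝟙 ((v , w) ∈? (a ∷ D))) ∎
    where open ≡-Reasoning

  indeg≡∑-in-arcs : ∀ (D : Arcs n) → Unique D → ∀ v → indeg D v ≡ ∑ (λ w → 𝟙 ((w , v) ∈? D))
  indeg≡∑-in-arcs [] _ v = sym ∑-0
  indeg≡∑-in-arcs (a ∷ D) (a∉D ∷ uniq) v = begin
      indeg (a ∷ D) v
    ≡⟨ count-∷ proj₂ a D v ⟩
      𝟙 (proj₂ a F.≟ v) + indeg D v
    ≡⟨ cong₂ _+_ (sym (∑-𝟙-in-arc a v)) (indeg≡∑-in-arcs D uniq v) ⟩
      ∑ (λ w → 𝟙 ((w , v) ≟ₐ a)) + ∑ (λ w → 𝟙 ((w , v) ∈? D))
    ≡⟨ trans (∑-cong (λ w → 𝟙-∈-∷ a∉D (w , v))) (∑-distrib-+′ _ _) ⟨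
      ∑ (λ w → 𝟙 ((w , v) ∈? (a ∷ D))) ∎
    where open ≡-Reasoning

  Adjacent : Arcs n → Fin n → Fin n → Set
  Adjacent D v w = (v , w) ∈ D ⊎ (w , v) ∈ D

  Adjacent-sym : ∀ {D v w} → Adjacent D v w → Adjacent D w v
  Adjacent-sym (inj₁ p) = inj₂ p
  Adjacent-sym (inj₂ p) = inj₁ p

  adjacent? : ∀ D v w → Dec (Adjacent D v w)
  adjacent? D v w with (v , w) ∈? D | (w , v) ∈? D
  ... | yes p | _ = yes (inj₁ p)
  ... | no _ | yes q = yes (inj₂ q)
  ... | no ¬p | no ¬q = no [ ¬p , ¬q ]

  deg : Arcs n → Fin n → ℕ
  deg D v = outdeg D v + indeg D v

  deg≡∑-adjacent : ∀ (D : Arcs n) → Unique D → (∀ v w → (v , w) ∈ D → (w , v) ∈ D → ⊥) →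
                   ∀ v → deg D v ≡ ∑ (λ w → 𝟙 (adjacent? D v w))
  deg≡∑-adjacent D uniq antisym v = begin
      outdeg D v + indeg D v
    ≡⟨ cong₂ _+_ (outdeg≡∑-out-arcs D uniq v) (indeg≡∑-in-arcs D uniq v) ⟩
      ∑ (λ w → 𝟙 ((v , w) ∈? D)) + ∑ (λ w → 𝟙 ((w , v) ∈? D))
    ≡⟨ ∑-distrib-+′ _ _ ⟨
      ∑ (λ w → 𝟙 ((v , w) ∈? D) + 𝟙 ((w , v) ∈? D))
    ≡⟨ ∑-cong (λ w → sym (𝟙-⊎ (λ x → x) (λ x → x) (antisym v w) (adjacent? D v w) ((v , w) ∈? D) ((w , v) ∈? D))) ⟩
      ∑ (λ w → 𝟙 (adjacent? D v w)) ∎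
    where open ≡-Reasoning

  ∑-deg≡2·length : ∀ (D : Arcs n) → ∑ (deg D) ≡ length D + length D
  ∑-deg≡2·length D = trans (∑-distrib-+′ (outdeg D) (indeg D))
                           (cong₂ _+_ (∑-count≡length proj₁ D) (∑-count≡length proj₂ D))

  twiceM1≤∑-deg² : ∀ (D : Arcs n) → twiceM1 D ≤ ∑ (λ v → deg D v * deg D v)
  twiceM1≤∑-deg² D = subst (_≤ ∑ (λ v → deg D v * deg D v)) (sym (twiceM1≡∑-squares D))
                       (∑-mono-≤ (λ v → square+square≤square-+ (outdeg D v) (indeg D v)))

  twiceM1≡∑-deg²⇔SinkSource : ∀ (D : Arcs n) → twiceM1 D ≡ ∑ (λ v → deg D v * deg D v) ⇔ SinkSource D
  twiceM1≡∑-deg²⇔SinkSource D = mk⇔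
    (λ e v → Equivalence.to (square+square≡square-+⇔ (outdeg D v) (indeg D v))
               (∑-mono-≤-≡⇒≡ (λ v → square+square≤square-+ (outdeg D v) (indeg D v))
                             (trans (sym (twiceM1≡∑-squares D)) e) v))
    (λ sink-source → trans (twiceM1≡∑-squares D)
       (∑-cong (λ v → Equivalence.from (square+square≡square-+⇔ (outdeg D v) (indeg D v)) (sink-source v))))

-- A forest has fewer edges than vertices

lookup-injective : ∀ {A : Set} {xs : List A} → Unique xs → ∀ {i j} → lookup xs i ≡ lookup xs j → i ≡ j
lookup-injective (_ ∷ _) {fzero} {fzero} _ = refl
lookup-injective (x∉xs ∷ _) {fzero} {fsuc j} e = ⊥-elim (All.lookup x∉xs (∈-lookup j) e)
lookup-injective (x∉xs ∷ _) {fsuc i} {fzero} e = ⊥-elim (All.lookup x∉xs (∈-lookup i) (sym e))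
lookup-injective (_ ∷ uniq) {fsuc i} {fsuc j} e = cong fsuc (lookup-injective uniq e)

module _ {n : ℕ} where

  data Walk (R : Fin n → Fin n → Set) : Fin n → Fin n → List (Fin n) → Set where
    []ʷ : ∀ {x} → Walk R x x []
    _∷ʷ_ : ∀ {x y z ys} → R x y → Walk R y z ys → Walk R x z (y ∷ ys)

  module _ {R : Fin n → Fin n → Set} where

    shortcut : ∀ {x y z ys} → Walk R y z ys → Unique (y ∷ ys) → x ∈ (y ∷ ys) →
               ∃ λ zs → Walk R x z zs × Unique (x ∷ zs)
    shortcut w uniq (here refl) = _ , w , uniq
    shortcut (_ ∷ʷ w) (_ ∷ uniq) (there x∈ys) = shortcut w uniq x∈ys

    Star⇒simple-walk : ∀ {x z} → Star R x z → ∃ λ ys → Walk R x z ys × Unique (x ∷ ys)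
    Star⇒simple-walk ε = [] , []ʷ , ([] ∷ [])
    Star⇒simple-walk {x} (_◅_ {j = y} r s) with Star⇒simple-walk s
    ... | ys , w , uniq with any? (x F.≟_) (y ∷ ys)
    ...   | yes x∈ = shortcut w uniq x∈
    ...   | no x∉ = y ∷ ys , r ∷ʷ w , (¬Any⇒All¬ _ x∉ ∷ uniq)

    walk-step : ∀ {x z ys} → Walk R x z ys → ∀ (i : Fin (length ys)) →
                R (lookup (x ∷ ys) (inject₁ i)) (lookup (x ∷ ys) (fsuc i))
    walk-step (r ∷ʷ w) fzero = r
    walk-step (r ∷ʷ w) (fsuc i) = walk-step w i

    walk-last : ∀ {x z ys} → Walk R x z ys → lookup (x ∷ ys) (fromℕ (length ys)) ≡ z
    walk-last []ʷ = refl
    walk-last (r ∷ʷ w) = walk-last w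

  closing-edge⇒HasCycle : ∀ (T : Graph n) {R : Fin n → Fin n → Set} → (∀ {x y} → R x y → T x y) →
                          ∀ {u w} → Star R u w → u ≢ w → ¬ R u w → T w u → HasCycle T
  closing-edge⇒HasCycle T R⊆T {u} {w} s u≢w ¬Ruw Twu with Star⇒simple-walk s
  ... | [] , []ʷ , _ = ⊥-elim (u≢w refl)
  ... | _ ∷ [] , r ∷ʷ []ʷ , _ = ⊥-elim (¬Ruw r)
  ... | y₁ ∷ y₂ ∷ ys , walk , uniq =
    length ys , lookup (u ∷ y₁ ∷ y₂ ∷ ys) , lookup-injective uniq ,
    (λ i → R⊆T (walk-step walk i)) , subst (λ v → T v u) (sym (walk-last walk)) Twu

  -- The classes of a forest's edge set are tracked by a labelling L with one root per class,
  -- so that adding an edge between two classes merges them and removes one root.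
  record Labelling (E : Arcs n) (L : Fin n → Fin n) : Set where
    field
      idempotent : ∀ x → L (L x) ≡ L x
      connects : ∀ x y → L x ≡ L y → Star (Adjacent E) x y

  roots : (Fin n → Fin n) → ℕ
  roots L = ∑ (λ x → 𝟙 (L x F.≟ x))

  Adjacent-∷ : ∀ {E : Arcs n} {a x y} → Adjacent E x y → Adjacent (a ∷ E) x y
  Adjacent-∷ (inj₁ p) = inj₁ (there p)
  Adjacent-∷ (inj₂ p) = inj₂ (there p)

  lift : ∀ {E : Arcs n} {a x y} → Star (Adjacent E) x y → Star (Adjacent (a ∷ E)) x y
  lift = Star.map Adjacent-∷

  merge : (Fin n → Fin n) → Fin n → Fin n → Fin n → Fin n
  merge L u w x with L x F.≟ L w
  ... | yes _ = L u
  ... | no _ = L x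

  merge-same : ∀ L u w x → L x ≡ L w → merge L u w x ≡ L u
  merge-same L u w x e with L x F.≟ L w
  ... | yes _ = refl
  ... | no ne = ⊥-elim (ne e)

  merge-other : ∀ L u w x → L x ≢ L w → merge L u w x ≡ L x
  merge-other L u w x ne with L x F.≟ L w
  ... | yes e = ⊥-elim (ne e)
  ... | no _ = refl

  module Merge {E : Arcs n} {L : Fin n → Fin n} (lab : Labelling E L) (u w : Fin n) (Lu≢Lw : L u ≢ L w) where
    open Labelling lab

    L′ : Fin n → Fin n
    L′ = merge L u w

    idempotent′ : ∀ x → L′ (L′ x) ≡ L′ x
    idempotent′ x = by-class (L x F.≟ L w)
      where
      open ≡-Reasoning
      by-class : Dec (L x ≡ L w) → L′ (L′ x) ≡ L′ x
      by-class (yes e) = begin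
        L′ (L′ x) ≡⟨ cong L′ (merge-same L u w x e) ⟩
        L′ (L u)  ≡⟨ merge-other L u w (L u) (λ e′ → Lu≢Lw (trans (sym (idempotent u)) e′)) ⟩
        L (L u)   ≡⟨ idempotent u ⟩
        L u       ≡⟨ merge-same L u w x e ⟨
        L′ x      ∎
      by-class (no ne) = begin
        L′ (L′ x) ≡⟨ cong L′ (merge-other L u w x ne) ⟩
        L′ (L x)  ≡⟨ merge-other L u w (L x) (λ e′ → ne (trans (sym (idempotent x)) e′)) ⟩
        L (L x)   ≡⟨ idempotent x ⟩
        L x       ≡⟨ merge-other L u w x ne ⟨
        L′ x      ∎

    connects′ : ∀ x y → L′ x ≡ L′ y → Star (Adjacent ((u , w) ∷ E)) x y
    connects′ x y e = by-class (L x F.≟ L w) (L y F.≟ L w)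
      where
      by-class : Dec (L x ≡ L w) → Dec (L y ≡ L w) → Star (Adjacent ((u , w) ∷ E)) x y
      by-class (yes ex) (yes ey) = lift (connects x y (trans ex (sym ey)))
      by-class (yes ex) (no ny) =
        lift (connects x w ex) ◅◅ (inj₂ (here refl) ◅
        lift (connects u y (trans (sym (merge-same L u w x ex)) (trans e (merge-other L u w y ny)))))
      by-class (no nx) (yes ey) =
        lift (connects x u (trans (sym (merge-other L u w x nx)) (trans e (merge-same L u w y ey)))) ◅◅
        (inj₁ (here refl) ◅ lift (connects w y (sym ey)))
      by-class (no nx) (no ny) =
        lift (connects x y (trans (sym (merge-other L u w x nx)) (trans e (merge-other L u w y ny))))

    labelling : Labelling ((u , w) ∷ E) L′
    labelling = record { idempotent = idempotent′ ; connects = connects′ }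

    𝟙-root : ∀ x → 𝟙 (L x F.≟ x) ≡ 𝟙 (L′ x F.≟ x) + 𝟙 (x F.≟ L w)
    𝟙-root x with x F.≟ L w
    ... | yes refl = begin
        𝟙 (L (L w) F.≟ L w)                ≡⟨ 𝟙-yes (idempotent w) _ ⟩
        1                                  ≡⟨ cong (_+ 1) (𝟙-no L′Lw≢Lw (L′ (L w) F.≟ L w)) ⟨
        𝟙 (L′ (L w) F.≟ L w) + 1           ∎
      where
      open ≡-Reasoning
      L′Lw≢Lw : L′ (L w) ≢ L w
      L′Lw≢Lw e = Lu≢Lw (trans (sym (merge-same L u w (L w) (idempotent w))) e)
    ... | no x≢Lw = by-class (L x F.≟ L w)
      where
      by-class : Dec (L x ≡ L w) → 𝟙 (L x F.≟ x) ≡ 𝟙 (L′ x F.≟ x) + 0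
      by-class (yes ex) = trans (𝟙-no (λ e → x≢Lw (trans (sym e) ex)) (L x F.≟ x))
                                (sym (trans (+-identityʳ _) (𝟙-no L′x≢x (L′ x F.≟ x))))
        where
        L′x≢x : L′ x ≢ x
        L′x≢x e = Lu≢Lw (trans (sym (idempotent u)) (trans (cong L (trans (sym (merge-same L u w x ex)) e)) ex))
      by-class (no nx) = sym (trans (+-identityʳ _) (cong (λ v → 𝟙 (v F.≟ x)) (merge-other L u w x nx)))

    roots-merge : roots L ≡ roots L′ + 1
    roots-merge = trans (∑-cong 𝟙-root) (trans (∑-distrib-+′ _ _) (cong (roots L′ +_) (∑-𝟙-≡ (L w))))

  acyclic⇒labelling : (T : Graph n) → IsSimple T → ¬ HasCycle T → ∀ (E : Arcs n) → Unique E →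
                      (∀ x y → (x , y) ∈ E → T x y) → (∀ x y → (x , y) ∈ E → (y , x) ∈ E → ⊥) →
                      Σ (Fin n → Fin n) λ L → Labelling E L × length E + roots L ≡ n
  acyclic⇒labelling T simple acyclic [] _ _ _ =
    (λ x → x) , record { idempotent = λ x → refl ; connects = λ x y e → subst (Star _ x) e ε } ,
    trans (∑-cong (λ x → 𝟙-yes refl (x F.≟ x))) ∑-1
  acyclic⇒labelling T (symmetric , irreflexive) acyclic ((u , w) ∷ E) (uw∉E ∷ uniq) E⊆T antisym
    with acyclic⇒labelling T (symmetric , irreflexive) acyclic E uniq (λ x y → E⊆T x y ∘ there)
                           (λ x y p q → antisym x y (there p) (there q))
  ... | L , lab , count≡n = merge L u w , labelling , (begin
        suc (length E) + roots (merge L u w) ≡⟨ +-suc (length E) _ ⟨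
        length E + suc (roots (merge L u w)) ≡⟨ cong (length E +_) (trans (+-comm 1 _) (sym roots-merge)) ⟩
        length E + roots L                   ≡⟨ count≡n ⟩
        n                                    ∎)
    where
    open ≡-Reasoning
    Tuw : T u w
    Tuw = E⊆T u w (here refl)
    Adjacent⇒T : ∀ {x y} → Adjacent E x y → T x y
    Adjacent⇒T {x} {y} (inj₁ p) = E⊆T x y (there p)
    Adjacent⇒T {x} {y} (inj₂ p) = symmetric y x (E⊆T y x (there p))
    ¬Adjacent : ¬ Adjacent E u w
    ¬Adjacent (inj₁ p) = All¬⇒¬Any uw∉E p
    ¬Adjacent (inj₂ p) = antisym u w (here refl) (there p)
    Lu≢Lw : L u ≢ L w
    Lu≢Lw e = acyclic (closing-edge⇒HasCycle T Adjacent⇒T (Labelling.connects lab u w e)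
                (λ u≡w → irreflexive u (subst (T u) (sym u≡w) Tuw)) ¬Adjacent (symmetric u w Tuw))
    open Merge lab u w Lu≢Lw

  acyclic⇒length<n : (T : Graph n) → IsSimple T → ¬ HasCycle T → ∀ (E : Arcs n) → Unique E →
                     (∀ x y → (x , y) ∈ E → T x y) → (∀ x y → (x , y) ∈ E → (y , x) ∈ E → ⊥) →
                     Fin n → length E < n
  acyclic⇒length<n T simple acyclic E uniq E⊆T antisym x₀
    with acyclic⇒labelling T simple acyclic E uniq E⊆T antisym
  ... | L , lab , count≡n = subst (length E <_) count≡n (begin-strict
        length E           <⟨ n<1+n _ ⟩
        suc (length E)     ≡⟨ +-comm 1 _ ⟩
        length E + 1       ≤⟨ +-monoʳ-≤ (length E) root ⟩
        length E + roots L ∎)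
    where
    open ≤-Reasoning
    root : 1 ≤ roots L
    root = subst (_≤ roots L) (𝟙-yes (Labelling.idempotent lab x₀) _) (term≤∑ (λ x → 𝟙 (L x F.≟ x)) (L x₀))

-- The degree inequality for matched pairs

record ExtremalDegrees (m : ℕ) (a b : Fin m → ℕ) : Set where
  field
    hub : Fin m
    top : Fin m → ℕ
    leaf-pair : ∀ j → (a j ≡ 1 × b j ≡ top j) ⊎ (b j ≡ 1 × a j ≡ top j)
    top-hub : top hub ≡ m
    top-other : ∀ j → j ≢ hub → top j ≡ 2

squeeze : ∀ {p q r} → p ≤ q → q ≤ r → r ≡ p → p ≡ q × q ≡ r
squeeze p≤q q≤r r≡p = p≡q , trans (sym p≡q) (sym r≡p)
  where p≡q = ≤-antisym p≤q (subst (_ ≤_) r≡p q≤r)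

pair-identity : ∀ p q t → p + q ≡ t + 1 →
                (p + 1) * (p + 1) + (q + 1) * (q + 1) + 2 * (p * q) ≡ t * t + 4 * t + 5
pair-identity p q t p+q≡t+1 = begin
    (p + 1) * (p + 1) + (q + 1) * (q + 1) + 2 * (p * q) ≡⟨ expand p q ⟩
    (p + q) * (p + q) + 2 * (p + q) + 2                 ≡⟨ cong (λ s → s * s + 2 * s + 2) p+q≡t+1 ⟩
    (t + 1) * (t + 1) + 2 * (t + 1) + 2                 ≡⟨ collect t ⟩
    t * t + 4 * t + 5                                   ∎
  where
  open ≡-Reasoning
  expand : ∀ p q → (p + 1) * (p + 1) + (q + 1) * (q + 1) + 2 * (p * q) ≡ (p + q) * (p + q) + 2 * (p + q) + 2
  expand = solve-∀
  collect : ∀ t → (t + 1) * (t + 1) + 2 * (t + 1) + 2 ≡ t * t + 4 * t + 5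
  collect = solve-∀

module PairedDegrees (K : ℕ) (a b : Fin (2 + K) → ℕ) (a≥1 : ∀ i → 1 ≤ a i) (b≥1 : ∀ i → 1 ≤ b i)
                     (a+b≥3 : ∀ i → 3 ≤ a i + b i) (∑a+b≤ : ∑ (λ i → a i + b i) + 2 ≤ 4 * (2 + K)) where
  m = 2 + K

  a′ b′ x : Fin m → ℕ
  a′ i = a i ∸ 1
  b′ i = b i ∸ 1
  x i = a i + b i ∸ 3

  A B X² X : ℕ
  A = ∑ (λ i → a i * a i + b i * b i)
  B = ∑ (λ i → a′ i * b′ i)
  X² = ∑ (λ i → x i * x i)
  X = ∑ x

  a′+1≡a : ∀ i → a′ i + 1 ≡ a i
  a′+1≡a i = m∸n+n≡m (a≥1 i)
  b′+1≡b : ∀ i → b′ i + 1 ≡ b i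
  b′+1≡b i = m∸n+n≡m (b≥1 i)
  x+3≡a+b : ∀ i → x i + 3 ≡ a i + b i
  x+3≡a+b i = m∸n+n≡m (a+b≥3 i)

  pair-identityᵢ : ∀ i → a i * a i + b i * b i + 2 * (a′ i * b′ i) ≡ x i * x i + 4 * x i + 5
  pair-identityᵢ i =
    subst₂ (λ p q → p * p + q * q + 2 * (a′ i * b′ i) ≡ x i * x i + 4 * x i + 5) (a′+1≡a i) (b′+1≡b i)
      (pair-identity (a′ i) (b′ i) (x i) (+-cancelʳ-≡ 2 _ _ (begin
        a′ i + b′ i + 2       ≡⟨ shuffle (a′ i) (b′ i) ⟩
        (a′ i + 1) + (b′ i + 1) ≡⟨ cong₂ _+_ (a′+1≡a i) (b′+1≡b i) ⟩
        a i + b i             ≡⟨ x+3≡a+b i ⟨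
        x i + 3               ≡⟨ +-assoc (x i) 1 2 ⟨
        x i + 1 + 2           ∎)))
    where
    open ≡-Reasoning
    shuffle : ∀ p q → p + q + 2 ≡ (p + 1) + (q + 1)
    shuffle = solve-∀

  ∑-pair-identity : A + 2 * B ≡ X² + 4 * X + m * 5
  ∑-pair-identity = begin
      A + 2 * B                                     ≡⟨ cong (A +_) (∑-*ˡ 2 _) ⟨
      A + ∑ (λ i → 2 * (a′ i * b′ i))               ≡⟨ ∑-distrib-+′ _ _ ⟨
      ∑ (λ i → a i * a i + b i * b i + 2 * (a′ i * b′ i)) ≡⟨ ∑-cong pair-identityᵢ ⟩
      ∑ (λ i → x i * x i + 4 * x i + 5)             ≡⟨ ∑-distrib-+′ _ _ ⟩
      ∑ (λ i → x i * x i + 4 * x i) + ∑ {m} (λ _ → 5) ≡⟨ cong₂ _+_ (∑-distrib-+′ _ _) (∑-const 5) ⟩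
      X² + ∑ (λ i → 4 * x i) + m * 5                ≡⟨ cong (λ t → X² + t + m * 5) (∑-*ˡ 4 x) ⟩
      X² + 4 * X + m * 5                            ∎
    where open ≡-Reasoning

  X≤K : X ≤ K
  X≤K = +-cancelʳ-≤ (m * 3 + 2) X K (begin
      X + (m * 3 + 2)               ≡⟨ +-assoc X (m * 3) 2 ⟨
      X + m * 3 + 2                 ≡⟨ cong (_+ 2) (trans (∑-distrib-+′ _ _) (cong (X +_) (∑-const 3))) ⟨
      ∑ (λ i → x i + 3) + 2         ≡⟨ cong (_+ 2) (∑-cong x+3≡a+b) ⟩
      ∑ (λ i → a i + b i) + 2       ≤⟨ ∑a+b≤ ⟩
      4 * m                         ≡⟨ regroup K ⟩
      K + (m * 3 + 2)               ∎)
    where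
    open ≤-Reasoning
    regroup : ∀ k → 4 * (2 + k) ≡ k + ((2 + k) * 3 + 2)
    regroup = solve-∀

  drop-B : A + 4 ≤ A + 2 * B + 4
  drop-B = +-monoˡ-≤ 4 (m≤m+n A (2 * B))

  convexity : A + 2 * B + 4 ≤ X * X + 4 * X + m * 5 + 4
  convexity = subst (_≤ X * X + 4 * X + m * 5 + 4) (cong (_+ 4) (sym ∑-pair-identity))
    (+-monoˡ-≤ 4 (+-monoˡ-≤ (m * 5) (+-monoˡ-≤ (4 * X) (∑-squares≤square-∑ x))))

  excess-bound : X * X + 4 * X + m * 5 + 4 ≤ K * K + 4 * K + m * 5 + 4
  excess-bound = +-monoˡ-≤ 4 (+-monoˡ-≤ (m * 5) (+-mono-≤ (*-mono-≤ X≤K X≤K) (*-monoʳ-≤ 4 X≤K)))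

  closed-form : K * K + 4 * K + m * 5 + 4 ≡ m * m + 5 * m
  closed-form = solve K
    where
    solve : ∀ k → k * k + 4 * k + (2 + k) * 5 + 4 ≡ (2 + k) * (2 + k) + 5 * (2 + k)
    solve = solve-∀

  bound : A + 4 ≤ m * m + 5 * m
  bound = subst (A + 4 ≤_) closed-form (≤-trans drop-B (≤-trans convexity excess-bound))

  module Equality (A+4≡ : A + 4 ≡ m * m + 5 * m) where
    tight₁ : A + 4 ≡ A + 2 * B + 4
    tight₁ = proj₁ (squeeze drop-B (≤-trans convexity excess-bound) (trans closed-form (sym A+4≡)))

    tight₂ : A + 2 * B + 4 ≡ X * X + 4 * X + m * 5 + 4
    tight₂ = proj₁ (squeeze convexity excess-bound (trans closed-form (trans (sym A+4≡) tight₁)))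

    tight₃ : X * X + 4 * X ≡ K * K + 4 * K
    tight₃ = +-cancelʳ-≡ (m * 5) _ _ (+-cancelʳ-≡ 4 _ _ (proj₂ (squeeze convexity excess-bound
               (trans closed-form (trans (sym A+4≡) tight₁)))))

    a′b′≡0 : ∀ i → a′ i * b′ i ≡ 0
    a′b′≡0 i = n≤0⇒n≡0 (subst (a′ i * b′ i ≤_) B≡0 (term≤∑ (λ i → a′ i * b′ i) i))
      where
      B≡0 : B ≡ 0
      B≡0 = 2*n≡0⇒n≡0 (+-cancelˡ-≡ A _ 0 (sym (trans (+-identityʳ A) (+-cancelʳ-≡ 4 _ _ tight₁))))

    X²≡X*X : X² ≡ X * X
    X²≡X*X = +-cancelʳ-≡ (4 * X) _ _ (+-cancelʳ-≡ (m * 5) _ _ (+-cancelʳ-≡ 4 _ _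
               (trans (cong (_+ 4) (sym ∑-pair-identity)) tight₂)))

    X≡K : X ≡ K
    X≡K with m≤n⇒m<n∨m≡n X≤K
    ... | inj₂ e = e
    ... | inj₁ X<K = ⊥-elim (<⇒≢ (+-mono-< (*-mono-< X<K X<K) (*-monoʳ-< 4 X<K)) tight₃)

    leaf-pair : ∀ j → (a j ≡ 1 × b j ≡ x j + 2) ⊎ (b j ≡ 1 × a j ≡ x j + 2)
    leaf-pair j with m*n≡0⇒m≡0∨n≡0 (a′ j) (a′b′≡0 j)
    ... | inj₁ a′≡0 = inj₁ (aj≡1 , +-cancelˡ-≡ 1 _ _ (trans (cong (_+ b j) (sym aj≡1)) (trans (sym (x+3≡a+b j)) (+-suc (x j) 2))))
      where aj≡1 = trans (sym (a′+1≡a j)) (cong (_+ 1) a′≡0)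
    ... | inj₂ b′≡0 = inj₂ (bj≡1 , +-cancelʳ-≡ 1 _ _ (trans (cong (a j +_) (sym bj≡1))
                                     (trans (sym (x+3≡a+b j)) (sym (+-assoc (x j) 2 1)))))
      where bj≡1 = trans (sym (b′+1≡b j)) (cong (_+ 1) b′≡0)

    extremal : ExtremalDegrees m a b
    extremal with ∑-squares≡square-∑⇒concentrated x X²≡X*X
    ... | j , xj≡X , others = record
      { hub = j
      ; top = λ i → x i + 2
      ; leaf-pair = leaf-pair
      ; top-hub = trans (cong (_+ 2) (trans xj≡X X≡K)) (+-comm K 2)
      ; top-other = λ i i≢j → cong (_+ 2) (others i i≢j)
      }

sum≤2⇒both≡1 : ∀ {p q} → 1 ≤ p → 1 ≤ q → p + q ≤ 2 → p ≡ 1 × q ≡ 1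
sum≤2⇒both≡1 {suc zero} {suc zero} _ _ _ = refl , refl
sum≤2⇒both≡1 {suc zero} {suc (suc q)} _ _ (s≤s (s≤s ()))
sum≤2⇒both≡1 {suc (suc p)} {suc q} _ _ (s≤s (s≤s p+1+q≤0)) with m+n≤o⇒n≤o p p+1+q≤0
... | ()

paired-degrees : ∀ m (a b : Fin m → ℕ) → 1 ≤ m → (∀ i → 1 ≤ a i) → (∀ i → 1 ≤ b i) →
                 (2 ≤ m → ∀ i → 3 ≤ a i + b i) → ∑ (λ i → a i + b i) + 2 ≤ 4 * m →
                 (∑ (λ i → a i * a i + b i * b i) + 4 ≤ m * m + 5 * m)
                 × (∑ (λ i → a i * a i + b i * b i) + 4 ≡ m * m + 5 * m → ExtremalDegrees m a b)
paired-degrees (suc zero) a b _ a≥1 b≥1 _ ∑≤ = ≤-reflexive A+4≡6 , λ _ → record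
  { hub = fzero
  ; top = λ _ → 1
  ; leaf-pair = λ { fzero → inj₁ ones }
  ; top-hub = refl
  ; top-other = λ { fzero 0≢0 → ⊥-elim (0≢0 refl) }
  }
  where
  single : ∀ (f : Fin 1 → ℕ) → ∑ f ≡ f fzero
  single f = trans (∑-suc f) (trans (cong (f fzero +_) (∑-empty _)) (+-identityʳ _))
  ones : a fzero ≡ 1 × b fzero ≡ 1
  ones = sum≤2⇒both≡1 (a≥1 fzero) (b≥1 fzero) (+-cancelʳ-≤ 2 _ 2 (subst (λ s → s + 2 ≤ 4) (single _) ∑≤))
  A+4≡6 : ∑ (λ i → a i * a i + b i * b i) + 4 ≡ 6
  A+4≡6 = trans (cong (_+ 4) (single _)) (cong₂ (λ p q → p * p + q * q + 4) (proj₁ ones) (proj₂ ones))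
paired-degrees (suc (suc K)) a b _ a≥1 b≥1 a+b≥3 ∑≤ =
  bound , λ A+4≡ → Equality.extremal A+4≡
  where open PairedDegrees K a b a≥1 b≥1 (a+b≥3 (s≤s (s≤s z≤n))) ∑≤

-- Oriented trees with a perfect matching

injective⇒surjective : ∀ {a b} (f : Fin a → Fin b) → (∀ {x y} → f x ≡ f y → x ≡ y) → b ≤ a →
                       ∀ y → ∃ λ x → f x ≡ y
injective⇒surjective {a} {suc b} f f-inj b≤a y with FP.any? (λ x → f x F.≟ y)
... | yes hit = hit
... | no miss = ⊥-elim (<-irrefl refl (≤-trans b≤a (FP.injective⇒≤ f′-inj)))
  where
  f′ : Fin a → Fin b
  f′ x = punchOut (λ e → miss (x , sym e))
  f′-inj : ∀ {x x′} → f′ x ≡ f′ x′ → x ≡ x′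
  f′-inj {x} {x′} e = f-inj (FP.punchOut-injective {i = y} (λ e → miss (x , sym e)) (λ e → miss (x′ , sym e)) e)

injective⇒permutation : ∀ {a b} (f : Fin a → Fin b) → (∀ {x y} → f x ≡ f y → x ≡ y) → b ≤ a → Permutation a b
injective⇒permutation f f-inj b≤a = permutation f (proj₁ ∘ surj) (proj₂ ∘ surj) (λ x → f-inj (proj₂ (surj (f x))))
  where surj = injective⇒surjective f f-inj b≤a

splitAt-injective : ∀ m {n} {x y : Fin (m + n)} → splitAt m x ≡ splitAt m y → x ≡ y
splitAt-injective m {n} {x} {y} e = trans (sym (FP.join-splitAt m n x)) (trans (cong (join m n) e) (FP.join-splitAt m n y))

2*m≡m+m : ∀ m → 2 * m ≡ m + m
2*m≡m+m m = cong (m +_) (+-identityʳ m)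

∑-halves : ∀ {m N} (φ : Permutation (m + m) N) (F : Fin N → ℕ) →
           ∑ F ≡ ∑ (λ i → F (φ ⟨$⟩ʳ (i ↑ˡ m))) + ∑ (λ i → F (φ ⟨$⟩ʳ (m ↑ʳ i)))
∑-halves {m} φ F = trans (∑-permute φ F) (∑-↑ m (λ i → F (φ ⟨$⟩ʳ i)))

module Orientation {n} {T : Graph n} (simple : IsSimple T) {D : Arcs n} (ori : IsOrientation T D) where

  private
    symmetric = proj₁ simple
    irreflexive = proj₂ simple
    uniq = proj₁ ori
    D⊆T = proj₁ (proj₂ ori)
    one-arc = proj₂ (proj₂ ori)

  antisym : ∀ v w → (v , w) ∈ D → (w , v) ∈ D → ⊥
  antisym v w p q = proj₂ (one-arc v w (D⊆T v w p)) (p , q)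

  Adjacent⇒T : ∀ {v w} → Adjacent D v w → T v w
  Adjacent⇒T {v} {w} (inj₁ p) = D⊆T v w p
  Adjacent⇒T {v} {w} (inj₂ p) = symmetric w v (D⊆T w v p)

  T⇒Adjacent : ∀ {v w} → T v w → Adjacent D v w
  T⇒Adjacent {v} {w} t = proj₁ (one-arc v w t)

  ¬Adjacent-self : ∀ {v} → ¬ Adjacent D v v
  ¬Adjacent-self {v} a = irreflexive v (Adjacent⇒T a)

  deg≡∑ : ∀ v → deg D v ≡ ∑ (λ w → 𝟙 (adjacent? D v w))
  deg≡∑ = deg≡∑-adjacent D uniq antisym

  neighbour⇒deg≥1 : ∀ {v w} → Adjacent D v w → 1 ≤ deg D v
  neighbour⇒deg≥1 {v} {w} a = subst (1 ≤_) (sym (deg≡∑ v))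
    (subst (_≤ _) (𝟙-yes a (adjacent? D v w)) (term≤∑ (λ w → 𝟙 (adjacent? D v w)) w))

  deg≤1⇒unique-neighbour : ∀ {v p w} → deg D v ≤ 1 → Adjacent D v p → Adjacent D v w → w ≡ p
  deg≤1⇒unique-neighbour {v} {p} {w} deg≤1 ap aw with w F.≟ p
  ... | yes w≡p = w≡p
  ... | no w≢p = ⊥-elim (<-irrefl refl (≤-trans two≤deg deg≤1))
    where
    two≤deg : 2 ≤ deg D v
    two≤deg = subst (_≤ deg D v) (cong₂ _+_ (𝟙-yes aw (adjacent? D v w)) (𝟙-yes ap (adjacent? D v p)))
                (≤-trans (two-terms≤∑ (λ x → 𝟙 (adjacent? D v x)) w p w≢p) (≤-reflexive (sym (deg≡∑ v))))

  deg≤2⇒two-neighbours : ∀ {v p q w} → deg D v ≤ 2 → Adjacent D v p → Adjacent D v q → p ≢ q →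
                         Adjacent D v w → w ≡ p ⊎ w ≡ q
  deg≤2⇒two-neighbours {v} {p} {q} {w} deg≤2 ap aq p≢q aw with w F.≟ p | w F.≟ q
  ... | yes w≡p | _ = inj₁ w≡p
  ... | no _ | yes w≡q = inj₂ w≡q
  ... | no w≢p | no w≢q = ⊥-elim (<-irrefl refl (≤-trans three≤deg deg≤2))
    where
    three≤deg : 3 ≤ deg D v
    three≤deg = subst (_≤ deg D v)
      (cong₂ _+_ (cong₂ _+_ (𝟙-yes aw (adjacent? D v w)) (𝟙-yes ap (adjacent? D v p))) (𝟙-yes aq (adjacent? D v q)))
      (≤-trans (three-terms≤∑ (λ x → 𝟙 (adjacent? D v x)) w p q w≢p w≢q p≢q) (≤-reflexive (sym (deg≡∑ v))))

another : ∀ {m} → 2 ≤ m → (i : Fin m) → ∃ λ j → j ≢ i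
another (s≤s (s≤s _)) fzero = fsuc fzero , λ ()
another (s≤s (s≤s _)) (fsuc i) = fzero , λ ()

module MatchedTree {m} {T : Graph (2 * m)} (tree : IsTree T) (matching : HasMatchingOfSize T m)
                   {D : Arcs (2 * m)} (ori : IsOrientation T D) where

  open Orientation (proj₁ tree) ori public

  private
    g = proj₁ matching
    h = proj₁ (proj₂ matching)
    gh = proj₁ (proj₂ (proj₂ matching))
    gh-inj = proj₂ (proj₂ (proj₂ matching))
    symmetric = proj₁ (proj₁ tree)
    connected = proj₁ (proj₂ tree)

  g≢h : ∀ i j → g i ≢ h j
  g≢h i j e with gh-inj {inj₁ i} {inj₂ j} e
  ... | ()

  g-injective : ∀ {i j} → g i ≡ g j → i ≡ j
  g-injective e = inj₁-injective (gh-inj e)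

  h-injective : ∀ {i j} → h i ≡ h j → i ≡ j
  h-injective e = inj₂-injective (gh-inj e)

  deg≥1 : 1 ≤ m → ∀ v → 1 ≤ deg D v
  deg≥1 m≥1 v with first-step (connected v (partner (v F.≟ g i₀))) (v≢partner (v F.≟ g i₀))
    where
    i₀ = fromℕ< m≥1
    partner : Dec (v ≡ g i₀) → Fin (2 * m)
    partner (yes _) = h i₀
    partner (no _) = g i₀
    v≢partner : (d : Dec (v ≡ g i₀)) → v ≢ partner d
    v≢partner (yes v≡g) v≡h = g≢h i₀ i₀ (trans (sym v≡g) v≡h)
    v≢partner (no v≢g) = v≢g
    first-step : ∀ {w} → Star T v w → v ≢ w → ∃ (T v)
    first-step ε v≢v = ⊥-elim (v≢v refl)
    first-step (t ◅ _) _ = _ , t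
  ... | _ , t = neighbour⇒deg≥1 (T⇒Adjacent t)

  matching-permutation : Permutation (m + m) (2 * m)
  matching-permutation = injective⇒permutation ([ g , h ] ∘ splitAt m)
    (λ e → splitAt-injective m (gh-inj e)) (≤-reflexive (2*m≡m+m m))

  ∑-matching : ∀ (F : Fin (2 * m) → ℕ) → ∑ F ≡ ∑ (λ i → F (g i) + F (h i))
  ∑-matching F = trans (∑-halves matching-permutation F) (trans (cong₂ _+_
    (∑-cong (λ i → cong (F ∘ [ g , h ]) (FP.splitAt-↑ˡ m i m)))
    (∑-cong (λ i → cong (F ∘ [ g , h ]) (FP.splitAt-↑ʳ m m i)))) (sym (∑-distrib-+′ _ _)))

  ∑-matched-degrees≤ : 1 ≤ m → ∑ (λ i → deg D (g i) + deg D (h i)) + 2 ≤ 4 * m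
  ∑-matched-degrees≤ m≥1 = begin
      ∑ (λ i → deg D (g i) + deg D (h i)) + 2 ≡⟨ cong (_+ 2) (∑-matching (deg D)) ⟨
      ∑ (deg D) + 2                           ≡⟨ cong (_+ 2) (∑-deg≡2·length D) ⟩
      length D + length D + 2                 ≡⟨ regroup (length D) ⟩
      suc (length D) + suc (length D)         ≤⟨ +-mono-≤ length<n length<n ⟩
      2 * m + 2 * m                           ≡⟨ regroup′ m ⟩
      4 * m                                   ∎
    where
    open ≤-Reasoning
    length<n : length D < 2 * m
    length<n = acyclic⇒length<n T (proj₁ tree) (proj₂ (proj₂ tree)) D (proj₁ ori) (proj₁ (proj₂ ori)) antisym
                 (g (fromℕ< m≥1))
    regroup : ∀ l → l + l + 2 ≡ suc l + suc l
    regroup = solve-∀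
    regroup′ : ∀ k → 2 * k + 2 * k ≡ 4 * k
    regroup′ = solve-∀

  leaf-pair-closed : ∀ i → deg D (g i) ≤ 1 → deg D (h i) ≤ 1 →
                     ∀ {y z} → (y ≡ g i ⊎ y ≡ h i) → Star T y z → z ≡ g i ⊎ z ≡ h i
  leaf-pair-closed i _ _ y∈ ε = y∈
  leaf-pair-closed i dg dh (inj₁ refl) (t ◅ s) =
    leaf-pair-closed i dg dh (inj₂ (deg≤1⇒unique-neighbour dg (T⇒Adjacent (gh i)) (T⇒Adjacent t))) s
  leaf-pair-closed i dg dh (inj₂ refl) (t ◅ s) =
    leaf-pair-closed i dg dh (inj₁ (deg≤1⇒unique-neighbour dh (T⇒Adjacent (symmetric _ _ (gh i))) (T⇒Adjacent t))) s

  matched-degrees≥3 : 2 ≤ m → ∀ i → 3 ≤ deg D (g i) + deg D (h i)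
  matched-degrees≥3 m≥2 i with 2 ≤? deg D (g i) | 2 ≤? deg D (h i)
  ... | yes dg≥2 | _ = +-mono-≤ dg≥2 (deg≥1 (≤-trans (s≤s z≤n) m≥2) (h i))
  ... | no _ | yes dh≥2 = subst (3 ≤_) (+-comm (deg D (h i)) (deg D (g i))) (+-mono-≤ dh≥2 (deg≥1 (≤-trans (s≤s z≤n) m≥2) (g i)))
  ... | no dg≱2 | no dh≱2 with another m≥2 i
  ...   | j , j≢i = ⊥-elim ([ j≢i ∘ g-injective , g≢h j i ]
          (leaf-pair-closed i (≤-pred (≰⇒> dg≱2)) (≤-pred (≰⇒> dh≱2)) (inj₁ refl) (connected (g i) (g j))))

-- The spider T_{2m,m}

T-adjacent : ℕ → ℕ → ℕ → Set
T-adjacent m a b = T-edge m a b ⊎ T-edge m b a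

module _ {m : ℕ} where

  private
    m+b≮m : ∀ {b} → ¬ (m + b < m)
    m+b≮m {b} m+b<m = <⇒≱ m+b<m (m≤m+n m b)

    c+m≮m : ∀ {c} → ¬ (c + m < m)
    c+m≮m {c} c+m<m = <⇒≱ c+m<m (m≤n+m m c)

    1≤⇒≢0 : ∀ {c} → 1 ≤ c → c ≢ 0
    1≤⇒≢0 (s≤s _) ()

  T-adjacent-inner-outer : 1 ≤ m → ∀ {a b} → a < m → T-adjacent m a (m + b) ⇔ a ≡ b
  T-adjacent-inner-outer m≥1 {a} {b} a<m = mk⇔ to from
    where
    to : T-adjacent m a (m + b) → a ≡ b
    to (inj₁ (inj₁ (a≡0 , _ , m+b≤m))) =
      trans a≡0 (sym (n≤0⇒n≡0 (+-cancelˡ-≤ m b 0 (subst (m + b ≤_) (sym (+-identityʳ m)) m+b≤m))))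
    to (inj₁ (inj₂ (_ , _ , m+b≡a+m))) = sym (+-cancelˡ-≡ m b a (trans m+b≡a+m (+-comm a m)))
    to (inj₂ (inj₁ (m+b≡0 , _))) = ⊥-elim (1≤⇒≢0 (≤-trans m≥1 (m≤m+n m b)) m+b≡0)
    to (inj₂ (inj₂ (_ , m+b<m , _))) = ⊥-elim (m+b≮m m+b<m)
    from : a ≡ b → T-adjacent m a (m + b)
    from refl = edge a a<m
      where
      edge : ∀ c → c < m → T-adjacent m c (m + c)
      edge zero _ = inj₁ (inj₁ (refl , ≤-trans m≥1 (m≤m+n m 0) , ≤-reflexive (+-identityʳ m)))
      edge (suc c) c<m = inj₁ (inj₂ (s≤s z≤n , c<m , +-comm m (suc c)))

  ¬T-adjacent-outer-outer : 1 ≤ m → ∀ a b → ¬ T-adjacent m (m + a) (m + b)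
  ¬T-adjacent-outer-outer m≥1 a b (inj₁ (inj₁ (m+a≡0 , _))) = 1≤⇒≢0 (≤-trans m≥1 (m≤m+n m a)) m+a≡0
  ¬T-adjacent-outer-outer m≥1 a b (inj₁ (inj₂ (_ , m+a<m , _))) = m+b≮m m+a<m
  ¬T-adjacent-outer-outer m≥1 a b (inj₂ (inj₁ (m+b≡0 , _))) = 1≤⇒≢0 (≤-trans m≥1 (m≤m+n m b)) m+b≡0
  ¬T-adjacent-outer-outer m≥1 a b (inj₂ (inj₂ (_ , m+b<m , _))) = m+b≮m m+b<m

  T-adjacent-inner-inner : ∀ {a b} → a < m → b < m →
                           T-adjacent m a b ⇔ ((a ≡ 0 × 1 ≤ b) ⊎ (b ≡ 0 × 1 ≤ a))
  T-adjacent-inner-inner {a} {b} a<m b<m = mk⇔ to from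
    where
    to : T-adjacent m a b → (a ≡ 0 × 1 ≤ b) ⊎ (b ≡ 0 × 1 ≤ a)
    to (inj₁ (inj₁ (a≡0 , b≥1 , _))) = inj₁ (a≡0 , b≥1)
    to (inj₁ (inj₂ (_ , _ , b≡a+m))) = ⊥-elim (c+m≮m (subst (_< m) b≡a+m b<m))
    to (inj₂ (inj₁ (b≡0 , a≥1 , _))) = inj₂ (b≡0 , a≥1)
    to (inj₂ (inj₂ (_ , _ , a≡b+m))) = ⊥-elim (c+m≮m (subst (_< m) a≡b+m a<m))
    from : (a ≡ 0 × 1 ≤ b) ⊎ (b ≡ 0 × 1 ≤ a) → T-adjacent m a b
    from (inj₁ (a≡0 , b≥1)) = inj₁ (inj₁ (a≡0 , b≥1 , <⇒≤ b<m))
    from (inj₂ (b≡0 , a≥1)) = inj₂ (inj₁ (b≡0 , a≥1 , <⇒≤ a<m))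

-- T_{2m,m} on Fin m ⊎ Fin m: inj₁ fzero is the centre, adjacent to every other inj₁ k, and each inj₁ k
-- carries the pendant vertex inj₂ k. Under `join` this is the numbering of T2mm (inj₂ fzero ↦ m).
Spider : ∀ {m} → Fin (suc m) ⊎ Fin (suc m) → Fin (suc m) ⊎ Fin (suc m) → Set
Spider (inj₁ k) (inj₂ k′) = k ≡ k′
Spider (inj₂ k) (inj₁ k′) = k ≡ k′
Spider (inj₂ _) (inj₂ _) = ⊥
Spider (inj₁ k) (inj₁ k′) = (k ≡ fzero × k′ ≢ fzero) ⊎ (k′ ≡ fzero × k ≢ fzero)

spider-index : ∀ {m} → Fin m ⊎ Fin m → ℕ
spider-index {m} s = toℕ (join m m s)

module _ {m′ : ℕ} where

  private
    m = suc m′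

    toℕ≡0⇔≡0 : ∀ {k : Fin m} → (toℕ k ≡ 0) ⇔ (k ≡ fzero)
    toℕ≡0⇔≡0 {fzero} = mk⇔ (λ _ → refl) (λ _ → refl)
    toℕ≡0⇔≡0 {fsuc k} = mk⇔ (λ ()) (λ ())

    1≤toℕ⇔≢0 : ∀ {k : Fin m} → (1 ≤ toℕ k) ⇔ (k ≢ fzero)
    1≤toℕ⇔≢0 {fzero} = mk⇔ (λ ()) (λ 0≢0 → ⊥-elim (0≢0 refl))
    1≤toℕ⇔≢0 {fsuc k} = mk⇔ (λ _ ()) (λ _ → s≤s z≤n)

    inner-inner : ∀ (k k′ : Fin m) →
                  ((toℕ k ≡ 0 × 1 ≤ toℕ k′) ⊎ (toℕ k′ ≡ 0 × 1 ≤ toℕ k)) ⇔ Spider (inj₁ k) (inj₁ k′)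
    inner-inner k k′ = mk⇔ to from
      where
      to : (toℕ k ≡ 0 × 1 ≤ toℕ k′) ⊎ (toℕ k′ ≡ 0 × 1 ≤ toℕ k) → Spider (inj₁ k) (inj₁ k′)
      to (inj₁ (k≡0 , k′≥1)) = inj₁ (Equivalence.to toℕ≡0⇔≡0 k≡0 , Equivalence.to 1≤toℕ⇔≢0 k′≥1)
      to (inj₂ (k′≡0 , k≥1)) = inj₂ (Equivalence.to toℕ≡0⇔≡0 k′≡0 , Equivalence.to 1≤toℕ⇔≢0 k≥1)
      from : Spider (inj₁ k) (inj₁ k′) → (toℕ k ≡ 0 × 1 ≤ toℕ k′) ⊎ (toℕ k′ ≡ 0 × 1 ≤ toℕ k)
      from (inj₁ (k≡0 , k′≢0)) = inj₁ (Equivalence.from toℕ≡0⇔≡0 k≡0 , Equivalence.from 1≤toℕ⇔≢0 k′≢0)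
      from (inj₂ (k′≡0 , k≢0)) = inj₂ (Equivalence.from toℕ≡0⇔≡0 k′≡0 , Equivalence.from 1≤toℕ⇔≢0 k≢0)

    m≥1 : 1 ≤ m
    m≥1 = s≤s z≤n

  T-adjacent⇔Spider : ∀ s t → T-adjacent m (spider-index s) (spider-index t) ⇔ Spider s t
  T-adjacent⇔Spider (inj₁ k) (inj₂ k′) =
    subst₂ (λ a b → T-adjacent m a b ⇔ (k ≡ k′)) (sym (FP.toℕ-↑ˡ k m)) (sym (FP.toℕ-↑ʳ m k′))
      (⇔-trans (T-adjacent-inner-outer m≥1 (FP.toℕ<n k)) (mk⇔ FP.toℕ-injective (cong toℕ)))
  T-adjacent⇔Spider (inj₂ k) (inj₁ k′) =
    subst₂ (λ a b → T-adjacent m a b ⇔ (k ≡ k′)) (sym (FP.toℕ-↑ʳ m k)) (sym (FP.toℕ-↑ˡ k′ m))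
      (⇔-trans (mk⇔ swap swap) (⇔-trans (T-adjacent-inner-outer m≥1 (FP.toℕ<n k′))
        (mk⇔ (sym ∘ FP.toℕ-injective) (cong toℕ ∘ sym))))
  T-adjacent⇔Spider (inj₂ k) (inj₂ k′) =
    subst₂ (λ a b → T-adjacent m a b ⇔ ⊥) (sym (FP.toℕ-↑ʳ m k)) (sym (FP.toℕ-↑ʳ m k′))
      (mk⇔ (¬T-adjacent-outer-outer m≥1 (toℕ k) (toℕ k′)) λ ())
  T-adjacent⇔Spider (inj₁ k) (inj₁ k′) =
    subst₂ (λ a b → T-adjacent m a b ⇔ Spider (inj₁ k) (inj₁ k′)) (sym (FP.toℕ-↑ˡ k m)) (sym (FP.toℕ-↑ˡ k′ m))
      (⇔-trans (T-adjacent-inner-inner (FP.toℕ<n k) (FP.toℕ<n k′)) (inner-inner k k′))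

SpiderLabelling : ∀ {m′} → Graph (2 * suc m′) → Set
SpiderLabelling {m′} T = Σ (Permutation (suc m′ + suc m′) (2 * suc m′)) λ π →
  ∀ s t → T (π ⟨$⟩ʳ join _ _ s) (π ⟨$⟩ʳ join _ _ t) ⇔ Spider s t

module _ {m′} {T : Graph (2 * suc m′)} where

  private
    m = suc m′
    m+m≡2m : m + m ≡ 2 * m
    m+m≡2m = sym (2*m≡m+m m)

  SpiderLabelling⇒≅ : SpiderLabelling T → T ≅ T2mm m
  SpiderLabelling⇒≅ (π , π-spider) = σ , λ u v →
    subst₂ (λ p q → T u v ⇔ T-adjacent m p q) (sym (toℕ-σ u)) (sym (toℕ-σ v))
      (subst₂ (λ u′ v′ → T u′ v′ ⇔ T-adjacent m (spider-index (label u)) (spider-index (label v)))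
              (relabel u) (relabel v)
        (⇔-trans (π-spider (label u) (label v)) (⇔-sym (T-adjacent⇔Spider (label u) (label v)))))
    where
    σ : Permutation′ (2 * m)
    σ = flip π ∘ₚ cast-id m+m≡2m
    label : Fin (2 * m) → Fin m ⊎ Fin m
    label u = splitAt m (π ⟨$⟩ˡ u)
    relabel : ∀ u → π ⟨$⟩ʳ join m m (label u) ≡ u
    relabel u = trans (cong (π ⟨$⟩ʳ_) (FP.join-splitAt m m (π ⟨$⟩ˡ u))) (P.inverseʳ π)
    toℕ-σ : ∀ u → toℕ (σ ⟨$⟩ʳ u) ≡ spider-index (label u)
    toℕ-σ u = trans (FP.toℕ-cast _ (π ⟨$⟩ˡ u)) (cong toℕ (sym (FP.join-splitAt m m (π ⟨$⟩ˡ u))))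

  ≅⇒SpiderLabelling : T ≅ T2mm m → SpiderLabelling T
  ≅⇒SpiderLabelling (σ , σ-iso) = π , λ s t →
    ⇔-trans (subst₂ (λ p q → T (π ⟨$⟩ʳ join m m s) (π ⟨$⟩ʳ join m m t) ⇔ T-adjacent m p q)
                    (toℕ-σπ s) (toℕ-σπ t) (σ-iso _ _))
            (T-adjacent⇔Spider s t)
    where
    π : Permutation (m + m) (2 * m)
    π = cast-id m+m≡2m ∘ₚ flip σ
    toℕ-σπ : ∀ s → toℕ (σ ⟨$⟩ʳ (π ⟨$⟩ʳ join m m s)) ≡ spider-index s
    toℕ-σπ s = trans (cong toℕ (P.inverseʳ σ)) (FP.toℕ-cast _ (join m m s))

module SpiderDegrees {m′} {T : Graph (2 * suc m′)} (simple : IsSimple T) {D : Arcs (2 * suc m′)}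
                     (ori : IsOrientation T D) (labelling : SpiderLabelling T) where
  open Orientation simple ori

  private
    m = suc m′
    π = proj₁ labelling
    π-spider = proj₂ labelling

    ν : Fin m ⊎ Fin m → Fin (2 * m)
    ν s = π ⟨$⟩ʳ join m m s

    Adjacent⇔Spider : ∀ s t → Adjacent D (ν s) (ν t) ⇔ Spider s t
    Adjacent⇔Spider s t = ⇔-trans (mk⇔ Adjacent⇒T T⇒Adjacent) (π-spider s t)

    𝟙-yes-spider : ∀ s t → Spider s t → 𝟙 (adjacent? D (ν s) (ν t)) ≡ 1
    𝟙-yes-spider s t st = 𝟙-yes (Equivalence.from (Adjacent⇔Spider s t) st) _

    𝟙-no-spider : ∀ s t → ¬ Spider s t → 𝟙 (adjacent? D (ν s) (ν t)) ≡ 0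
    𝟙-no-spider s t ¬st = 𝟙-no (¬st ∘ Equivalence.to (Adjacent⇔Spider s t)) _

    ∑-𝟙-spider : ∀ s (f : Fin m → Fin m ⊎ Fin m) c → (∀ k → Spider s (f k) ⇔ (k ≡ c)) →
                 ∑ (λ k → 𝟙 (adjacent? D (ν s) (ν (f k)))) ≡ 1
    ∑-𝟙-spider s f c st⇔ = trans (∑-cong (λ k → 𝟙-cong (Equivalence.to (⇔-trans (Adjacent⇔Spider s (f k)) (st⇔ k)))
                                                          (Equivalence.from (⇔-trans (Adjacent⇔Spider s (f k)) (st⇔ k)))
                                                          _ (k F.≟ c)))
                                     (∑-𝟙-≡ c)

    deg-ν : ∀ s → deg D (ν s) ≡ ∑ (λ k → 𝟙 (adjacent? D (ν s) (ν (inj₁ k))))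
                                + ∑ (λ k → 𝟙 (adjacent? D (ν s) (ν (inj₂ k))))
    deg-ν s = trans (deg≡∑ (ν s)) (∑-halves π _)

  deg-centre : deg D (ν (inj₁ fzero)) ≡ m
  deg-centre = begin
      deg D (ν (inj₁ fzero))                               ≡⟨ deg-ν (inj₁ fzero) ⟩
      ∑ (λ k → 𝟙 (adjacent? D c (ν (inj₁ k)))) + ∑ (λ k → 𝟙 (adjacent? D c (ν (inj₂ k))))
        ≡⟨ cong₂ _+_ (∑-suc _) (∑-𝟙-spider (inj₁ fzero) inj₂ fzero (λ k → mk⇔ sym sym)) ⟩
      𝟙 (adjacent? D c c) + ∑ (λ k → 𝟙 (adjacent? D c (ν (inj₁ (fsuc k))))) + 1
        ≡⟨ cong (_+ 1) (cong₂ _+_ (𝟙-no-spider (inj₁ fzero) (inj₁ fzero) c≁c)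
                                   (trans (∑-cong (λ k → 𝟙-yes-spider (inj₁ fzero) (inj₁ (fsuc k)) (inj₁ (refl , λ ())))) ∑-1)) ⟩
      m′ + 1                                               ≡⟨ +-comm m′ 1 ⟩
      m                                                    ∎
    where
    open ≡-Reasoning
    c = ν (inj₁ fzero)
    c≁c : ¬ Spider (inj₁ fzero) (inj₁ fzero)
    c≁c = [ (λ (_ , 0≢0) → 0≢0 refl) , (λ (_ , 0≢0) → 0≢0 refl) ]

  deg-inner : ∀ j → deg D (ν (inj₁ (fsuc j))) ≡ 2
  deg-inner j = trans (deg-ν (inj₁ (fsuc j))) (cong₂ _+_
    (∑-𝟙-spider (inj₁ (fsuc j)) inj₁ fzero (λ k → mk⇔ [ (λ { (() , _) }) , proj₁ ] (λ k≡0 → inj₂ (k≡0 , λ ()))))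
    (∑-𝟙-spider (inj₁ (fsuc j)) inj₂ (fsuc j) (λ k → mk⇔ sym sym)))

  deg-outer : ∀ j → deg D (ν (inj₂ j)) ≡ 1
  deg-outer j = trans (deg-ν (inj₂ j)) (cong₂ _+_
    (∑-𝟙-spider (inj₂ j) inj₁ j (λ k → mk⇔ sym sym))
    (trans (∑-cong (λ k → 𝟙-no-spider (inj₂ j) (inj₂ k) (λ ()))) ∑-0))

  ∑-deg²+4 : ∑ (λ v → deg D v * deg D v) + 4 ≡ m * m + 5 * m
  ∑-deg²+4 = begin
      ∑ (λ v → deg D v * deg D v) + 4
        ≡⟨ cong (_+ 4) (∑-halves π _) ⟩
      ∑ (λ k → deg D (ν (inj₁ k)) * deg D (ν (inj₁ k))) + ∑ (λ k → deg D (ν (inj₂ k)) * deg D (ν (inj₂ k))) + 4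
        ≡⟨ cong₂ (λ p q → p + q + 4)
             (trans (∑-suc _) (cong₂ _+_ (cong₂ _*_ deg-centre deg-centre)
                                         (trans (∑-cong (λ k → cong₂ _*_ (deg-inner k) (deg-inner k))) (∑-const 4))))
             (trans (∑-cong (λ k → cong₂ _*_ (deg-outer k) (deg-outer k))) ∑-1) ⟩
      m * m + m′ * 4 + m + 4
        ≡⟨ collect m′ ⟩
      m * m + 5 * m ∎
    where
    open ≡-Reasoning
    collect : ∀ k → suc k * suc k + k * 4 + suc k + 4 ≡ suc k * suc k + 5 * suc k
    collect = solve-∀

-- Trees attaining the bound

module ExtremalTree {m′} {T : Graph (2 * suc m′)} (tree : IsTree T) (matching : HasMatchingOfSize T (suc m′))
                    {D : Arcs (2 * suc m′)} (ori : IsOrientation T D)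
                    (extremal : ExtremalDegrees (suc m′) (deg D ∘ proj₁ matching) (deg D ∘ proj₁ (proj₂ matching)))
                    where
  open MatchedTree tree matching ori
  open ExtremalDegrees extremal

  private
    m = suc m′
    g = proj₁ matching
    h = proj₁ (proj₂ matching)
    gh = proj₁ (proj₂ (proj₂ matching))
    symmetric = proj₁ (proj₁ tree)

  record Roles (j : Fin m) : Set where
    field
      inner outer : Fin (2 * m)
      assignment : (inner ≡ h j × outer ≡ g j) ⊎ (inner ≡ g j × outer ≡ h j)
      deg-outer : deg D outer ≡ 1
      deg-inner : deg D inner ≡ top j

  roles : ∀ j → Roles j
  roles j with leaf-pair j
  ... | inj₁ (dg≡1 , dh≡top) = record
    { inner = h j ; outer = g j ; assignment = inj₁ (refl , refl) ; deg-outer = dg≡1 ; deg-inner = dh≡top }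
  ... | inj₂ (dh≡1 , dg≡top) = record
    { inner = g j ; outer = h j ; assignment = inj₂ (refl , refl) ; deg-outer = dh≡1 ; deg-inner = dg≡top }

  inner outer : Fin m → Fin (2 * m)
  inner j = Roles.inner (roles j)
  outer j = Roles.outer (roles j)

  _∈pair_ : Fin (2 * m) → Fin m → Set
  v ∈pair j = v ≡ g j ⊎ v ≡ h j

  ∈pair-unique : ∀ {v j k} → v ∈pair j → v ∈pair k → j ≡ k
  ∈pair-unique (inj₁ v≡gj) (inj₁ v≡gk) = g-injective (trans (sym v≡gj) v≡gk)
  ∈pair-unique {j = j} {k} (inj₁ v≡gj) (inj₂ v≡hk) = ⊥-elim (g≢h j k (trans (sym v≡gj) v≡hk))
  ∈pair-unique {j = j} {k} (inj₂ v≡hj) (inj₁ v≡gk) = ⊥-elim (g≢h k j (trans (sym v≡gk) v≡hj))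
  ∈pair-unique (inj₂ v≡hj) (inj₂ v≡hk) = h-injective (trans (sym v≡hj) v≡hk)

  inner∈pair : ∀ j → inner j ∈pair j
  inner∈pair j = [ inj₂ ∘ proj₁ , inj₁ ∘ proj₁ ]′ (Roles.assignment (roles j))

  outer∈pair : ∀ j → outer j ∈pair j
  outer∈pair j = [ inj₁ ∘ proj₂ , inj₂ ∘ proj₂ ]′ (Roles.assignment (roles j))

  inner-injective : ∀ {j k} → inner j ≡ inner k → j ≡ k
  inner-injective {j} {k} e = ∈pair-unique (inner∈pair j) (subst (_∈pair k) (sym e) (inner∈pair k))

  outer-injective : ∀ {j k} → outer j ≡ outer k → j ≡ k
  outer-injective {j} {k} e = ∈pair-unique (outer∈pair j) (subst (_∈pair k) (sym e) (outer∈pair k))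

  inner≢outer : ∀ j k → inner j ≢ outer k
  inner≢outer j k e with ∈pair-unique (inner∈pair j) (subst (_∈pair k) (sym e) (outer∈pair k))
  ... | refl with Roles.assignment (roles j)
  ...   | inj₁ (i≡h , o≡g) = g≢h j j (trans (sym o≡g) (trans (sym e) i≡h))
  ...   | inj₂ (i≡g , o≡h) = g≢h j j (trans (sym i≡g) (trans e o≡h))

  inner-outer-adjacent : ∀ j → Adjacent D (inner j) (outer j)
  inner-outer-adjacent j with Roles.assignment (roles j)
  ... | inj₁ (i≡h , o≡g) = T⇒Adjacent (subst₂ T (sym i≡h) (sym o≡g) (symmetric _ _ (gh j)))
  ... | inj₂ (i≡g , o≡h) = T⇒Adjacent (subst₂ T (sym i≡g) (sym o≡h) (gh j))

  ∑-roles : ∀ (F : Fin (2 * m) → ℕ) → ∑ F ≡ ∑ (λ k → F (inner k) + F (outer k))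
  ∑-roles F = trans (∑-matching F) (∑-cong swap-roles)
    where
    swap-roles : ∀ k → F (g k) + F (h k) ≡ F (inner k) + F (outer k)
    swap-roles k with Roles.assignment (roles k)
    ... | inj₁ (i≡h , o≡g) = trans (+-comm (F (g k)) (F (h k))) (cong₂ (λ u v → F u + F v) (sym i≡h) (sym o≡g))
    ... | inj₂ (i≡g , o≡h) = cong₂ (λ u v → F u + F v) (sym i≡g) (sym o≡h)

  outer-neighbour : ∀ j {w} → Adjacent D (outer j) w → w ≡ inner j
  outer-neighbour j = deg≤1⇒unique-neighbour (≤-reflexive (Roles.deg-outer (roles j)))
                        (Adjacent-sym (inner-outer-adjacent j))

  centre : Fin (2 * m)
  centre = inner hub

  centre≁outer : ∀ k → k ≢ hub → ¬ Adjacent D centre (outer k)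
  centre≁outer k k≢hub a = k≢hub (inner-injective (sym (outer-neighbour k (Adjacent-sym a))))

  -- The centre has degree m, and apart from its own leaf it can only see the m - 1 other inner vertices.
  centre-adjacent : ∀ j → j ≢ hub → Adjacent D centre (inner j)
  centre-adjacent j j≢hub = decidable-stable (adjacent? D centre (inner j)) λ ¬a →
    <-irrefl ∑t≡m (∑-indicators<n t j t≤1 (cong₂ _+_ (𝟙-no ¬a (adjacent? D centre (inner j)))
                                               (𝟙-no (centre≁outer j j≢hub) (adjacent? D centre (outer j)))))
    where
    t : Fin m → ℕ
    t k = 𝟙 (adjacent? D centre (inner k)) + 𝟙 (adjacent? D centre (outer k))
    t≤1 : ∀ k → t k ≤ 1
    t≤1 k with k F.≟ hub
    ... | yes refl = subst (_≤ 1) (cong (_+ 𝟙 (adjacent? D centre (outer hub))) (sym (𝟙-no ¬Adjacent-self (adjacent? D centre centre))))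
                       (𝟙≤1 (adjacent? D centre (outer hub)))
    ... | no k≢hub = subst (_≤ 1) (trans (sym (+-identityʳ _))
                                          (cong (𝟙 (adjacent? D centre (inner k)) +_) (sym (𝟙-no (centre≁outer k k≢hub) (adjacent? D centre (outer k))))))
                       (𝟙≤1 (adjacent? D centre (inner k)))
    ∑t≡m : ∑ t ≡ m
    ∑t≡m = trans (sym (∑-roles _)) (trans (sym (deg≡∑ centre)) (trans (Roles.deg-inner (roles hub)) top-hub))

  inner-neighbours : ∀ j → j ≢ hub → ∀ {w} → Adjacent D (inner j) w → w ≡ outer j ⊎ w ≡ centre
  inner-neighbours j j≢hub = deg≤2⇒two-neighbours (≤-reflexive (trans (Roles.deg-inner (roles j)) (top-other j j≢hub)))
    (inner-outer-adjacent j) (Adjacent-sym (centre-adjacent j j≢hub)) (λ e → inner≢outer hub j (sym e))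

  private
    τ : Permutation′ m
    τ = transpose fzero hub

    τ-injective : ∀ {k k′} → τ ⟨$⟩ʳ k ≡ τ ⟨$⟩ʳ k′ → k ≡ k′
    τ-injective {k} {k′} e = trans (sym (P.inverseˡ τ)) (trans (cong (τ ⟨$⟩ˡ_) e) (P.inverseˡ τ))

    τ-≢hub : ∀ {k} → k ≢ fzero → τ ⟨$⟩ʳ k ≢ hub
    τ-≢hub k≢0 e = k≢0 (τ-injective e)

  -- Relabelled so that the hub pair becomes pair fzero, the centre of the spider.
  ν : Fin m ⊎ Fin m → Fin (2 * m)
  ν (inj₁ k) = inner (τ ⟨$⟩ʳ k)
  ν (inj₂ k) = outer (τ ⟨$⟩ʳ k)

  ν-injective : ∀ {s t} → ν s ≡ ν t → s ≡ t
  ν-injective {inj₁ k} {inj₁ k′} e = cong inj₁ (τ-injective (inner-injective e))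
  ν-injective {inj₁ k} {inj₂ k′} e = ⊥-elim (inner≢outer _ _ e)
  ν-injective {inj₂ k} {inj₁ k′} e = ⊥-elim (inner≢outer _ _ (sym e))
  ν-injective {inj₂ k} {inj₂ k′} e = cong inj₂ (τ-injective (outer-injective e))

  Adjacent⇔Spider : ∀ s t → Adjacent D (ν s) (ν t) ⇔ Spider s t
  Adjacent⇔Spider (inj₁ k) (inj₂ k′) =
    mk⇔ (λ a → τ-injective (inner-injective (outer-neighbour (τ ⟨$⟩ʳ k′) (Adjacent-sym a))))
        (λ { refl → inner-outer-adjacent (τ ⟨$⟩ʳ k) })
  Adjacent⇔Spider (inj₂ k) (inj₁ k′) =
    mk⇔ (λ a → τ-injective (inner-injective (sym (outer-neighbour (τ ⟨$⟩ʳ k) a))))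
        (λ { refl → Adjacent-sym (inner-outer-adjacent (τ ⟨$⟩ʳ k)) })
  Adjacent⇔Spider (inj₂ k) (inj₂ k′) =
    mk⇔ (λ a → inner≢outer (τ ⟨$⟩ʳ k) (τ ⟨$⟩ʳ k′) (sym (outer-neighbour (τ ⟨$⟩ʳ k) a))) λ ()
  Adjacent⇔Spider (inj₁ k) (inj₁ k′) = mk⇔ (to (k F.≟ fzero) (k′ F.≟ fzero)) from
    where
    to : Dec (k ≡ fzero) → Dec (k′ ≡ fzero) → Adjacent D (ν (inj₁ k)) (ν (inj₁ k′)) → Spider (inj₁ k) (inj₁ k′)
    to (yes k≡0) (yes k′≡0) a = ⊥-elim (¬Adjacent-self (subst (λ z → Adjacent D (ν (inj₁ k)) (ν (inj₁ z))) (trans k′≡0 (sym k≡0)) a))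
    to (yes k≡0) (no k′≢0) _ = inj₁ (k≡0 , k′≢0)
    to (no k≢0) (yes k′≡0) _ = inj₂ (k′≡0 , k≢0)
    to (no k≢0) (no k′≢0) a with inner-neighbours (τ ⟨$⟩ʳ k) (τ-≢hub k≢0) a
    ... | inj₁ inner≡outer = ⊥-elim (inner≢outer _ _ inner≡outer)
    ... | inj₂ inner≡centre = ⊥-elim (τ-≢hub k′≢0 (inner-injective inner≡centre))
    from : Spider (inj₁ k) (inj₁ k′) → Adjacent D (ν (inj₁ k)) (ν (inj₁ k′))
    from (inj₁ (refl , k′≢0)) = centre-adjacent (τ ⟨$⟩ʳ k′) (τ-≢hub k′≢0)
    from (inj₂ (refl , k≢0)) = Adjacent-sym (centre-adjacent (τ ⟨$⟩ʳ k) (τ-≢hub k≢0))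

  spider-labelling : SpiderLabelling T
  spider-labelling = π , λ s t →
    subst₂ (λ u v → T u v ⇔ Spider s t) (cong ν (sym (FP.splitAt-join m m s))) (cong ν (sym (FP.splitAt-join m m t)))
      (⇔-trans (mk⇔ T⇒Adjacent Adjacent⇒T) (Adjacent⇔Spider s t))
    where
    π : Permutation (m + m) (2 * m)
    π = injective⇒permutation (ν ∘ splitAt m) (splitAt-injective m ∘ ν-injective) (≤-reflexive (2*m≡m+m m))

lemma8 : (m : ℕ) → 1 ≤ m → (T : Graph (2 * m)) → IsTree T → MatchingNumber T m →
         (D : Arcs (2 * m)) → IsOrientation T D →
         (twiceM1 D + 4 ≤ m * m + 5 * m)
         × (twiceM1 D + 4 ≡ m * m + 5 * m ⇔ (SinkSource D × T ≅ T2mm m))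
lemma8 m@(suc m′) m≥1 T tree (matching , _) D ori = bound , mk⇔ extremal sink-source-spider
  where
  open MatchedTree tree matching ori
  g = proj₁ matching
  h = proj₁ (proj₂ matching)
  ∑deg² = ∑ (λ v → deg D v * deg D v)

  paired : (∑deg² + 4 ≤ m * m + 5 * m) × (∑deg² + 4 ≡ m * m + 5 * m → ExtremalDegrees m (deg D ∘ g) (deg D ∘ h))
  paired = subst (λ s → (s + 4 ≤ m * m + 5 * m) × (s + 4 ≡ m * m + 5 * m → ExtremalDegrees m (deg D ∘ g) (deg D ∘ h)))
             (sym (∑-matching (λ v → deg D v * deg D v)))
             (paired-degrees m (deg D ∘ g) (deg D ∘ h) m≥1 (deg≥1 m≥1 ∘ g) (deg≥1 m≥1 ∘ h)
                             matched-degrees≥3 (∑-matched-degrees≤ m≥1))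

  bound : twiceM1 D + 4 ≤ m * m + 5 * m
  bound = ≤-trans (+-monoˡ-≤ 4 (twiceM1≤∑-deg² D)) (proj₁ paired)

  extremal : twiceM1 D + 4 ≡ m * m + 5 * m → SinkSource D × T ≅ T2mm m
  extremal eq with squeeze (+-monoˡ-≤ 4 (twiceM1≤∑-deg² D)) (proj₁ paired) (sym eq)
  ... | tight , tight′ =
    Equivalence.to (twiceM1≡∑-deg²⇔SinkSource D) (+-cancelʳ-≡ 4 _ _ tight) ,
    SpiderLabelling⇒≅ (ExtremalTree.spider-labelling tree matching ori (proj₂ paired tight′))

  sink-source-spider : SinkSource D × T ≅ T2mm m → twiceM1 D + 4 ≡ m * m + 5 * m
  sink-source-spider (sink-source , iso) =
    trans (cong (_+ 4) (Equivalence.from (twiceM1≡∑-deg²⇔SinkSource D) sink-source))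
          (SpiderDegrees.∑-deg²+4 (proj₁ tree) ori (≅⇒SpiderLabelling iso))
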